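{- Let $f=f(y,z)$ be the formal power series $$f=\frac{(1-y-z)-\sqrt{(1-y-z)^2-4yz}}{2}.$$ Then $f$ satisfies $f=(y+f)(z+f)$, and for all integers $k\ge 0$, $n\ge 1$ and $0\le r\le n$, the number $N_k^{n,r}$ equals the coefficient of $y^r z^{n-r}$ in $(y+z+2f)^{k+1}$.
   Context: A walk is a lattice path in $\mathbb{Z}^2$ using unit steps E $(+1,0)$ and N $(0,+1)$. For integers $0\le r\le n$, consider walks from $(0,0)$ to $(r,n-r)$. The number of intersection points of two such walks is the number of lattice points lying on both walks, excluding the initial vertex $(0,0)$ and the terminal vertex $(r,n-r)$. $N_k^{n,r}$ denotes the number of ordered pairs of such walks having exactly $k$ intersection points. The square root is the formal power series in $y,z$ with constant term $1$. -}

module Defs where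

open import Data.Bool using (Bool; true; false)
import Data.Bool
open import Data.Nat as ℕ using (ℕ; zero; suc; _∸_)
open import Data.Integer as ℤ using (ℤ; +_; -_; _+_; _-_; _*_)
open import Data.List using (List; []; _∷_; map; foldr; filter; length; upTo; concatMap; drop; reverse)
open import Data.List.Relation.Unary.Any using (any?)
open import Data.Vec using (Vec; []; _∷_; count)
open import Data.Product using (_×_; _,_; proj₁; proj₂)
open import Data.Product.Properties using (≡-dec)
open import Relation.Binary.PropositionalEquality using (_≡_)
open import Relation.Nullary.Decidable using (Dec)
open import Function using (_∘_)

-- Walks: a walk with n steps is a Vec Bool n, true = E (+1,0), false = N (0,+1)

Walk : ℕ → Set
Walk n = Vec Bool n

allWalks : (n : ℕ) → List (Walk n)
allWalks zero = [] ∷ []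
allWalks (suc n) = concatMap (λ w → (true ∷ w) ∷ (false ∷ w) ∷ []) (allWalks n)

isE : Bool → Bool
isE b = b

walksTo : (n r : ℕ) → List (Walk n)
walksTo n r = filter (λ w → count (λ b → Data.Bool._≟_ b true) w ℕ.≟ r) (allWalks n)

Point : Set
Point = ℕ × ℕ

pointsFrom : ∀ {n} → Point → Walk n → List Point
pointsFrom p [] = p ∷ []
pointsFrom (a , b) (true ∷ w) = (a , b) ∷ pointsFrom (suc a , b) w
pointsFrom (a , b) (false ∷ w) = (a , b) ∷ pointsFrom (a , suc b) w

points : ∀ {n} → Walk n → List Point
points = pointsFrom (0 , 0)

interiorPoints : ∀ {n} → Walk n → List Point
interiorPoints w = drop 1 (reverse (drop 1 (reverse (points w))))

_≟P_ : (p q : Point) → Dec (p ≡ q)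
_≟P_ = ≡-dec ℕ._≟_ ℕ._≟_

-- number of lattice points on both walks, excluding (0,0) and (r,n-r)
-- (for two walks with common endpoints: the points of w₁ other than its
-- endpoints which also lie on w₂)
intersections : ∀ {n} → Walk n → Walk n → ℕ
intersections w₁ w₂ =
  length (filter (λ p → any? (p ≟P_) (points w₂)) (interiorPoints w₁))

N : (k n r : ℕ) → ℕ
N k n r = length (filter (λ pq → intersections (proj₁ pq) (proj₂ pq) ℕ.≟ k)
                   (concatMap (λ w₁ → map (λ w₂ → (w₁ , w₂)) (walksTo n r)) (walksTo n r)))

-- Formal power series in y, z with integer coefficients:
-- F i j = coefficient of y^i z^j

PS : Set
PS = ℕ → ℕ → ℤ

infix 4 _≈_
infixl 6 _⊕_ _⊖_
infixl 7 _⊛_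
infixr 8 _^S_

_≈_ : PS → PS → Set
F ≈ G = ∀ i j → F i j ≡ G i j

sumℤ : List ℤ → ℤ
sumℤ = foldr _+_ (+ 0)

_⊕_ : PS → PS → PS
(F ⊕ G) i j = F i j + G i j

_⊖_ : PS → PS → PS
(F ⊖ G) i j = F i j - G i j

_⊛_ : PS → PS → PS
(F ⊛ G) i j = sumℤ (map (λ a → sumℤ (map (λ b → F a b * G (i ∸ a) (j ∸ b)) (upTo (suc j)))) (upTo (suc i)))

scale : ℤ → PS → PS
scale c F i j = c * F i j

oneS : PS
oneS zero zero = + 1
oneS _ _ = + 0

yS : PS
yS 1 0 = + 1
yS _ _ = + 0

zS : PS
zS 0 1 = + 1
zS _ _ = + 0

_^S_ : PS → ℕ → PS
F ^S zero = oneS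
F ^S suc k = F ⊛ (F ^S k)

disc : PS
disc = ((oneS ⊖ yS ⊖ zS) ⊛ (oneS ⊖ yS ⊖ zS)) ⊖ scale (+ 4) (yS ⊛ zS)

IsSqrt : PS → PS → Set
IsSqrt g s = (g 0 0 ≡ + 1) × ((g ⊛ g) ≈ s)

module Submission where

-- Follow two walks of the same length through their offset d, the number of east steps of the
-- first minus that of the second; they share a lattice point exactly when d = 0. Splitting off
-- the first step gives a linear recursion for the generating series S d k of pairs with offset d
-- and k meetings, and cutting at the first return to offset 0 gives S 0 (k + 1) = E · S 0 k with
-- E = y + z + y Q⁺ + z Q⁻, where Q± count first passages from ±1 to 0. First passages factor
-- (S (e + 1) = Q⁺ · S e), which turns the recursion into Q⁺ = z M and Q⁻ = y M with
-- M = 1 + (y + z) M + y z M²; so f = y Q⁺ = z Q⁻ satisfies f = (y + f)(z + f) and E = y + z + 2f.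
-- Then (1 - y - z - 2f)² = (1 - y - z)² - 4yz, and a square root with constant term 1 is unique
-- since a product with a factor of constant term 2 vanishes only if the other factor does.
-- Identities between series fixed by such recursions are proved by induction on total degree.

open import Algebra.Bundles using (CommutativeRing)
open import Data.Nat using (ℕ; zero; suc; _∸_; _≤_; _<_; s≤s; z≤n)
import Data.Nat.Properties as ℕP
open import Data.List using (List; foldr; applyUpTo)
open import Data.Product using (_,_)

module PowerSeries {c ℓ} (R : CommutativeRing c ℓ) where

  open CommutativeRing R
  open import Algebra.Structures using (IsCommutativeRing)
  import Algebra.Construct.Pointwise ℕ as Pointwise
  open import Algebra.Properties.CommutativeSemigroup +-commutativeSemigroup using (interchange)
  open import Relation.Binary.Reasoning.Setoid setoid

  Series : Set c
  Series = ℕ → Carrier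

  infix 4 _≋_
  infixl 6 _+ₛ_
  infixl 7 _*ₛ_ _·ₛ_

  _≋_ : Series → Series → Set ℓ
  f ≋ g = ∀ i → f i ≈ g i

  _+ₛ_ : Series → Series → Series
  (f +ₛ g) i = f i + g i

  -ₛ_ : Series → Series
  (-ₛ f) i = - f i

  0ₛ : Series
  0ₛ _ = 0#

  1ₛ : Series
  1ₛ zero = 1#
  1ₛ (suc _) = 0#

  shift : Series → Series
  shift f i = f (suc i)

  _·ₛ_ : Carrier → Series → Series
  (a ·ₛ f) i = a * f i

  _*ₛ_ : Series → Series → Series
  (f *ₛ g) zero = f 0 * g 0
  (f *ₛ g) (suc i) = f 0 * g (suc i) + (shift f *ₛ g) i

  *ₛ-as-sum : ∀ f g i → (f *ₛ g) i ≈ foldr _+_ 0# (applyUpTo (λ a → f a * g (i ∸ a)) (suc i))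
  *ₛ-as-sum f g zero = sym (+-identityʳ _)
  *ₛ-as-sum f g (suc i) = +-cong refl (*ₛ-as-sum (shift f) g i)

  *ₛ-cong : ∀ {f f′ g g′} → f ≋ f′ → g ≋ g′ → f *ₛ g ≋ f′ *ₛ g′
  *ₛ-cong f≋f′ g≋g′ zero = *-cong (f≋f′ 0) (g≋g′ 0)
  *ₛ-cong f≋f′ g≋g′ (suc i) = +-cong (*-cong (f≋f′ 0) (g≋g′ (suc i))) (*ₛ-cong (λ i → f≋f′ (suc i)) g≋g′ i)

  *ₛ-distribˡ : ∀ f g h → f *ₛ (g +ₛ h) ≋ f *ₛ g +ₛ f *ₛ h
  *ₛ-distribˡ f g h zero = distribˡ (f 0) (g 0) (h 0)
  *ₛ-distribˡ f g h (suc i) = begin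
    f 0 * (g (suc i) + h (suc i)) + (shift f *ₛ (g +ₛ h)) i
      ≈⟨ +-cong (distribˡ (f 0) _ _) (*ₛ-distribˡ (shift f) g h i) ⟩
    (f 0 * g (suc i) + f 0 * h (suc i)) + ((shift f *ₛ g) i + (shift f *ₛ h) i)
      ≈⟨ interchange _ _ _ _ ⟩
    (f *ₛ g) (suc i) + (f *ₛ h) (suc i) ∎

  *ₛ-zeroˡ : ∀ g → 0ₛ *ₛ g ≋ 0ₛ
  *ₛ-zeroˡ g zero = zeroˡ (g 0)
  *ₛ-zeroˡ g (suc i) = trans (+-cong (zeroˡ _) (*ₛ-zeroˡ g i)) (+-identityˡ 0#)

  *ₛ-identityˡ : ∀ f → 1ₛ *ₛ f ≋ f
  *ₛ-identityˡ f zero = *-identityˡ (f 0)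
  *ₛ-identityˡ f (suc i) = trans (+-cong (*-identityˡ _) (*ₛ-zeroˡ f i)) (+-identityʳ _)

  *ₛ-unfoldʳ : ∀ f g i → (f *ₛ g) (suc i) ≈ (f *ₛ shift g) i + f (suc i) * g 0
  *ₛ-unfoldʳ f g zero = refl
  *ₛ-unfoldʳ f g (suc i) = begin
    f 0 * g (suc (suc i)) + (shift f *ₛ g) (suc i)
      ≈⟨ +-cong refl (*ₛ-unfoldʳ (shift f) g i) ⟩
    f 0 * g (suc (suc i)) + ((shift f *ₛ shift g) i + f (suc (suc i)) * g 0)
      ≈⟨ sym (+-assoc _ _ _) ⟩
    (f *ₛ shift g) (suc i) + f (suc (suc i)) * g 0 ∎

  *ₛ-comm : ∀ f g → f *ₛ g ≋ g *ₛ f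
  *ₛ-comm f g zero = *-comm (f 0) (g 0)
  *ₛ-comm f g (suc i) = begin
    f 0 * g (suc i) + (shift f *ₛ g) i ≈⟨ +-cong (*-comm _ _) (*ₛ-comm (shift f) g i) ⟩
    g (suc i) * f 0 + (g *ₛ shift f) i ≈⟨ +-comm _ _ ⟩
    (g *ₛ shift f) i + g (suc i) * f 0 ≈⟨ sym (*ₛ-unfoldʳ g f i) ⟩
    (g *ₛ f) (suc i) ∎

  *ₛ-distribʳ : ∀ h f g → (f +ₛ g) *ₛ h ≋ f *ₛ h +ₛ g *ₛ h
  *ₛ-distribʳ h f g i = begin
    ((f +ₛ g) *ₛ h) i ≈⟨ *ₛ-comm (f +ₛ g) h i ⟩
    (h *ₛ (f +ₛ g)) i ≈⟨ *ₛ-distribˡ h f g i ⟩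
    (h *ₛ f) i + (h *ₛ g) i ≈⟨ +-cong (*ₛ-comm h f i) (*ₛ-comm h g i) ⟩
    (f *ₛ h) i + (g *ₛ h) i ∎

  *ₛ-scaleˡ : ∀ a f g → (a ·ₛ f) *ₛ g ≋ a ·ₛ (f *ₛ g)
  *ₛ-scaleˡ a f g zero = *-assoc a (f 0) (g 0)
  *ₛ-scaleˡ a f g (suc i) = begin
    a * f 0 * g (suc i) + ((a ·ₛ shift f) *ₛ g) i
      ≈⟨ +-cong (*-assoc a _ _) (*ₛ-scaleˡ a (shift f) g i) ⟩
    a * (f 0 * g (suc i)) + a * (shift f *ₛ g) i
      ≈⟨ sym (distribˡ a _ _) ⟩
    a * (f *ₛ g) (suc i) ∎

  -- The tail of f *ₛ g is (f 0 ·ₛ shift g) +ₛ (shift f *ₛ g) on the nose.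
  *ₛ-assoc : ∀ f g h → (f *ₛ g) *ₛ h ≋ f *ₛ (g *ₛ h)
  *ₛ-assoc f g h zero = *-assoc (f 0) (g 0) (h 0)
  *ₛ-assoc f g h (suc i) = begin
    (f 0 * g 0) * h (suc i) + (shift (f *ₛ g) *ₛ h) i
      ≈⟨ +-cong (*-assoc _ _ _) (*ₛ-distribʳ h (f 0 ·ₛ shift g) (shift f *ₛ g) i) ⟩
    f 0 * (g 0 * h (suc i)) + (((f 0 ·ₛ shift g) *ₛ h) i + ((shift f *ₛ g) *ₛ h) i)
      ≈⟨ +-cong refl (+-cong (*ₛ-scaleˡ (f 0) (shift g) h i) (*ₛ-assoc (shift f) g h i)) ⟩
    f 0 * (g 0 * h (suc i)) + (f 0 * (shift g *ₛ h) i + (shift f *ₛ (g *ₛ h)) i)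
      ≈⟨ sym (+-assoc _ _ _) ⟩
    (f 0 * (g 0 * h (suc i)) + f 0 * (shift g *ₛ h) i) + (shift f *ₛ (g *ₛ h)) i
      ≈⟨ +-cong (sym (distribˡ _ _ _)) refl ⟩
    (f *ₛ (g *ₛ h)) (suc i) ∎

  isCommutativeRingₛ : IsCommutativeRing _≋_ _+ₛ_ _*ₛ_ -ₛ_ 0ₛ 1ₛ
  isCommutativeRingₛ = record
    { isRing = record
      { +-isAbelianGroup = Pointwise.isAbelianGroup +-isAbelianGroup
      ; *-cong = *ₛ-cong
      ; *-assoc = *ₛ-assoc
      ; *-identity = *ₛ-identityˡ , λ f i → trans (*ₛ-comm f 1ₛ i) (*ₛ-identityˡ f i)
      ; distrib = *ₛ-distribˡ , *ₛ-distribʳ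
      }
    ; *-comm = *ₛ-comm
    }

  commutativeRing : CommutativeRing c ℓ
  commutativeRing = record { isCommutativeRing = isCommutativeRingₛ }

  *ₛ-constantˡ : ∀ k g → (∀ i → k (suc i) ≈ 0#) → k *ₛ g ≋ k 0 ·ₛ g
  *ₛ-constantˡ k g k≈const zero = refl
  *ₛ-constantˡ k g k≈const (suc i) =
    trans (+-cong refl (trans (*ₛ-cong k≈const (λ _ → refl) i) (*ₛ-zeroˡ g i))) (+-identityʳ _)

  *ₛ-leadingˡ : ∀ h k j → (∀ b → b < j → h b ≈ 0#) → (h *ₛ k) j ≈ h j * k 0
  *ₛ-leadingˡ h k zero h≈0 = refl
  *ₛ-leadingˡ h k (suc j) h≈0 = begin
    h 0 * k (suc j) + (shift h *ₛ k) j
      ≈⟨ +-cong (*-cong (h≈0 0 (s≤s z≤n)) refl) (*ₛ-leadingˡ (shift h) k j (λ b b<j → h≈0 (suc b) (s≤s b<j))) ⟩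
    0# * k (suc j) + h (suc j) * k 0 ≈⟨ trans (+-cong (zeroˡ _) refl) (+-identityˡ _) ⟩
    h (suc j) * k 0 ∎

  *ₛ-local : ∀ j f f′ g g′ → (∀ b → b ≤ j → f b ≈ f′ b) → (∀ b → b ≤ j → g b ≈ g′ b) →
             (f *ₛ g) j ≈ (f′ *ₛ g′) j
  *ₛ-local zero f f′ g g′ f≈ g≈ = *-cong (f≈ 0 z≤n) (g≈ 0 z≤n)
  *ₛ-local (suc j) f f′ g g′ f≈ g≈ = +-cong (*-cong (f≈ 0 z≤n) (g≈ (suc j) ℕP.≤-refl))
    (*ₛ-local j (shift f) (shift f′) g g′ (λ b b≤j → f≈ (suc b) (s≤s b≤j)) (λ b b≤j → g≈ b (ℕP.m≤n⇒m≤1+n b≤j)))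

module Bivariate where

  open import Defs
  open import Data.Nat as ℕ using (ℕ; zero; suc; _∸_; _≤_; _<_; z≤n; s≤s)
  import Data.Nat.Properties as ℕP
  open import Data.Integer as ℤ using (ℤ; +_)
  import Data.Integer.Properties as ℤP
  open import Data.List using (List; []; _∷_; map; foldr; upTo; applyUpTo)
  open import Data.List.Properties using (map-upTo; map-applyUpTo; map-cong)
  open import Data.Maybe using (Maybe; just; nothing)
  open import Relation.Nullary using (yes; no)
  open import Data.Nat.Induction using (<-rec)
  open import Relation.Binary.PropositionalEquality using (_≡_; _≢_; refl; sym; trans; cong; cong₂; subst; module ≡-Reasoning)
  open import Algebra.Solver.Ring.AlmostCommutativeRing
    using (AlmostCommutativeRing; _-Raw-AlmostCommutative⟶_; fromCommutativeRing)

  -- A PS F is read in ℤ[[z]][[y]]: F i is the coefficient of yⁱ, a series in z.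
  module ℤ[[z]] = PowerSeries ℤP.+-*-commutativeRing
  module ℤ[[y,z]] = PowerSeries ℤ[[z]].commutativeRing

  open CommutativeRing ℤ[[y,z]].commutativeRing public
    using () renaming (_+_ to _⊞_; _*_ to _⊠_; -_ to ⊟_; 0# to 𝟘; 1# to 𝟙; _≈_ to _≋_)
  module Ser = CommutativeRing ℤ[[y,z]].commutativeRing

  evaluate-sum : ∀ (Fs : List ℤ[[z]].Series) j → foldr ℤ[[z]]._+ₛ_ ℤ[[z]].0ₛ Fs j ≡ sumℤ (map (λ F → F j) Fs)
  evaluate-sum [] j = refl
  evaluate-sum (F ∷ Fs) j = cong (λ s → F j ℤ.+ s) (evaluate-sum Fs j)

  sum-upTo : ∀ (h : ℕ → ℤ) n → sumℤ (map h (upTo n)) ≡ sumℤ (applyUpTo h n)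
  sum-upTo h n = cong sumℤ (map-upTo h n)

  ⊛≋⊠ : ∀ F G → F ⊛ G ≋ F ⊠ G
  ⊛≋⊠ F G i j = sym (begin
    (F ⊠ G) i j
      ≡⟨ ℤ[[y,z]].*ₛ-as-sum F G i j ⟩
    foldr ℤ[[z]]._+ₛ_ ℤ[[z]].0ₛ (applyUpTo (λ a → (F a ℤ[[z]].*ₛ G (i ∸ a))) (suc i)) j
      ≡⟨ evaluate-sum (applyUpTo (λ a → F a ℤ[[z]].*ₛ G (i ∸ a)) (suc i)) j ⟩
    sumℤ (map (λ H → H j) (applyUpTo (λ a → F a ℤ[[z]].*ₛ G (i ∸ a)) (suc i)))
      ≡⟨ cong sumℤ (map-applyUpTo (λ a → F a ℤ[[z]].*ₛ G (i ∸ a)) (λ H → H j) (suc i)) ⟩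
    sumℤ (applyUpTo (λ a → (F a ℤ[[z]].*ₛ G (i ∸ a)) j) (suc i))
      ≡⟨ cong sumℤ (applyUpTo-cong row (suc i)) ⟩
    sumℤ (applyUpTo (λ a → sumℤ (map (λ b → F a b ℤ.* G (i ∸ a) (j ∸ b)) (upTo (suc j)))) (suc i))
      ≡⟨ sym (sum-upTo (λ a → sumℤ (map (λ b → F a b ℤ.* G (i ∸ a) (j ∸ b)) (upTo (suc j)))) (suc i)) ⟩
    (F ⊛ G) i j ∎)
    where
    open ≡-Reasoning
    row : ∀ a → (F a ℤ[[z]].*ₛ G (i ∸ a)) j ≡ sumℤ (map (λ b → F a b ℤ.* G (i ∸ a) (j ∸ b)) (upTo (suc j)))
    row a = trans (ℤ[[z]].*ₛ-as-sum (F a) (G (i ∸ a)) j) (sym (sum-upTo (λ b → F a b ℤ.* G (i ∸ a) (j ∸ b)) (suc j)))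
    applyUpTo-cong : ∀ {f g : ℕ → ℤ} → (∀ a → f a ≡ g a) → ∀ n → applyUpTo f n ≡ applyUpTo g n
    applyUpTo-cong {f} {g} f≗g n = trans (sym (map-upTo f n)) (trans (map-cong f≗g (upTo n)) (map-upTo g n))

  constant : ℤ → PS
  constant a zero zero = a
  constant a zero (suc _) = + 0
  constant a (suc _) _ = + 0

  constant⊠ : ∀ c F → constant c ⊠ F ≋ scale c F
  constant⊠ c F i j = begin
    (constant c ⊠ F) i j
      ≡⟨ ℤ[[y,z]].*ₛ-constantˡ (constant c) F (λ _ _ → refl) i j ⟩
    (constant c 0 ℤ[[z]].*ₛ F i) j
      ≡⟨ ℤ[[z]].*ₛ-constantˡ (constant c 0) (F i) (λ _ → refl) j ⟩
    c ℤ.* F i j ∎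
    where open ≡-Reasoning

  -- The unit as the ring solver sees it: it agrees with 𝟙 only pointwise.
  𝟏 : PS
  𝟏 = constant (+ 1)

  𝟏≋𝟙 : 𝟏 ≋ 𝟙
  𝟏≋𝟙 zero zero = refl
  𝟏≋𝟙 zero (suc j) = refl
  𝟏≋𝟙 (suc i) j = refl

  oneS≋𝟙 : oneS ≋ 𝟙
  oneS≋𝟙 zero zero = refl
  oneS≋𝟙 zero (suc j) = refl
  oneS≋𝟙 (suc i) j = refl

  private
    constant-*-homo : ∀ a b → constant (a ℤ.* b) ≋ constant a ⊠ constant b
    constant-*-homo a b i j = trans (scaled i j) (sym (constant⊠ a (constant b) i j))
      where
      scaled : ∀ i j → constant (a ℤ.* b) i j ≡ a ℤ.* constant b i j
      scaled zero zero = refl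
      scaled zero (suc j) = sym (ℤP.*-zeroʳ a)
      scaled (suc i) j = sym (ℤP.*-zeroʳ a)

    constant-+-homo : ∀ a b → constant (a ℤ.+ b) ≋ constant a ⊞ constant b
    constant-+-homo a b zero zero = refl
    constant-+-homo a b zero (suc j) = refl
    constant-+-homo a b (suc i) j = refl

    constant-neg-homo : ∀ a → constant (ℤ.- a) ≋ ⊟ constant a
    constant-neg-homo a zero zero = refl
    constant-neg-homo a zero (suc j) = refl
    constant-neg-homo a (suc i) j = refl

    constant-0-homo : constant (+ 0) ≋ 𝟘
    constant-0-homo zero zero = refl
    constant-0-homo zero (suc j) = refl
    constant-0-homo (suc i) j = refl

    ℤ[[y,z]]-almost : AlmostCommutativeRing _ _
    ℤ[[y,z]]-almost = fromCommutativeRing ℤ[[y,z]].commutativeRing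

    constant-morphism : ℤ.+-*-rawRing -Raw-AlmostCommutative⟶ ℤ[[y,z]]-almost
    constant-morphism = record
      { ⟦_⟧ = constant
      ; +-homo = constant-+-homo
      ; *-homo = constant-*-homo
      ; -‿homo = constant-neg-homo
      ; 0-homo = constant-0-homo
      ; 1-homo = 𝟏≋𝟙
      }

    constant-≟ : ∀ a b → Maybe (constant a ≋ constant b)
    constant-≟ a b with a ℤ.≟ b
    ... | yes refl = just (λ _ _ → refl)
    ... | no _ = nothing

  open import Algebra.Solver.Ring ℤ.+-*-rawRing ℤ[[y,z]]-almost constant-morphism constant-≟ public
    using (solve; _:+_; _:*_; :-_; con; _:=_)

  yS⊠-zero : ∀ A j → (yS ⊠ A) 0 j ≡ + 0
  yS⊠-zero A j = ℤ[[z]].*ₛ-zeroˡ (A 0) j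

  yS⊠-suc : ∀ A i j → (yS ⊠ A) (suc i) j ≡ A i j
  yS⊠-suc A i j = begin
    (yS ⊠ A) (suc i) j ≡⟨ cong (λ t → t ℤ.+ (ℤ[[y,z]].shift yS ⊠ A) i j) (ℤ[[z]].*ₛ-zeroˡ (A (suc i)) j) ⟩
    + 0 ℤ.+ (ℤ[[y,z]].shift yS ⊠ A) i j ≡⟨ ℤP.+-identityˡ _ ⟩
    (ℤ[[y,z]].shift yS ⊠ A) i j ≡⟨ ℤ[[y,z]].*ₛ-cong shift-yS (λ _ _ → refl) i j ⟩
    (𝟙 ⊠ A) i j ≡⟨ Ser.*-identityˡ A i j ⟩
    A i j ∎
    where
    open ≡-Reasoning
    shift-yS : ℤ[[y,z]].shift yS ≋ 𝟙
    shift-yS zero zero = refl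
    shift-yS zero (suc b) = refl
    shift-yS (suc a) b = refl

  zS⊠-row : ∀ A i j → (zS ⊠ A) i j ≡ (zS 0 ℤ[[z]].*ₛ A i) j
  zS⊠-row A zero j = refl
  zS⊠-row A (suc i) j = trans (cong (λ t → (zS 0 ℤ[[z]].*ₛ A (suc i)) j ℤ.+ t) (ℤ[[y,z]].*ₛ-zeroˡ A i j)) (ℤP.+-identityʳ _)

  zS⊠-zero : ∀ A i → (zS ⊠ A) i 0 ≡ + 0
  zS⊠-zero A i = zS⊠-row A i 0

  zS⊠-suc : ∀ A i j → (zS ⊠ A) i (suc j) ≡ A i j
  zS⊠-suc A i j = begin
    (zS ⊠ A) i (suc j) ≡⟨ zS⊠-row A i (suc j) ⟩
    + 0 ℤ.+ (ℤ[[z]].shift (zS 0) ℤ[[z]].*ₛ A i) j ≡⟨ ℤP.+-identityˡ _ ⟩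
    (ℤ[[z]].shift (zS 0) ℤ[[z]].*ₛ A i) j ≡⟨ ℤ[[z]].*ₛ-cong shift-zS (λ _ → refl) j ⟩
    (ℤ[[z]].1ₛ ℤ[[z]].*ₛ A i) j ≡⟨ ℤ[[z]].*ₛ-identityˡ (A i) j ⟩
    A i j ∎
    where
    open ≡-Reasoning
    shift-zS : ℤ[[z]].shift (zS 0) ℤ[[z]].≋ ℤ[[z]].1ₛ
    shift-zS zero = refl
    shift-zS (suc b) = refl

  yS⊠-cancel : ∀ {A B} → yS ⊠ A ≋ yS ⊠ B → A ≋ B
  yS⊠-cancel {A} {B} eq i j = trans (sym (yS⊠-suc A i j)) (trans (eq (suc i) j) (yS⊠-suc B i j))

  zS⊠-cancel : ∀ {A B} → zS ⊠ A ≋ zS ⊠ B → A ≋ B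
  zS⊠-cancel {A} {B} eq i j = trans (sym (zS⊠-suc A i j)) (trans (eq i (suc j)) (zS⊠-suc B i j))

  ⊠≋𝟘⇒≋𝟘 : ∀ H K → H ⊠ K ≋ 𝟘 → K 0 0 ≢ + 0 → H ≋ 𝟘
  ⊠≋𝟘⇒≋𝟘 H K HK≋𝟘 K00≢0 = <-rec _ row
    where
    row : ∀ a → (∀ {a′} → a′ < a → ∀ b → H a′ b ≡ + 0) → ∀ b → H a b ≡ + 0
    row a above = <-rec _ column
      where
      column : ∀ b → (∀ {b′} → b′ < b → H a b′ ≡ + 0) → H a b ≡ + 0
      column b left = ℤP.*-cancelʳ-≡ (H a b) (+ 0) (K 0 0) {{ℤ.≢-nonZero K00≢0}} (begin
        H a b ℤ.* K 0 0 ≡⟨ sym (ℤ[[z]].*ₛ-leadingˡ (H a) (K 0) b (λ b′ b′<b → left b′<b)) ⟩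
        (H a ℤ[[z]].*ₛ K 0) b ≡⟨ sym (ℤ[[y,z]].*ₛ-leadingˡ H K a (λ a′ a′<a → above a′<a) b) ⟩
        (H ⊠ K) a b ≡⟨ HK≋𝟘 a b ⟩
        + 0 ≡⟨ sym (ℤP.*-zeroˡ (K 0 0)) ⟩
        + 0 ℤ.* K 0 0 ∎)
        where open ≡-Reasoning

  AgreeBelow : ℕ → PS → PS → Set
  AgreeBelow D A B = ∀ i j → i ℕ.+ j < D → A i j ≡ B i j

  agreeBelow-≋ : ∀ {D A B} → A ≋ B → AgreeBelow D A B
  agreeBelow-≋ A≋B i j _ = A≋B i j

  agreeBelow-sym : ∀ {D A B} → AgreeBelow D A B → AgreeBelow D B A
  agreeBelow-sym A~B i j d = sym (A~B i j d)

  agreeBelow-trans : ∀ {D A B C} → AgreeBelow D A B → AgreeBelow D B C → AgreeBelow D A C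
  agreeBelow-trans A~B B~C i j d = trans (A~B i j d) (B~C i j d)

  agreeBelow-≤ : ∀ {D D′ A B} → D ≤ D′ → AgreeBelow D′ A B → AgreeBelow D A B
  agreeBelow-≤ D≤D′ A~B i j d = A~B i j (ℕP.<-≤-trans d D≤D′)

  agreeBelow-all : ∀ {A B} → (∀ D → AgreeBelow D A B) → A ≋ B
  agreeBelow-all A~B i j = A~B (suc (i ℕ.+ j)) i j ℕP.≤-refl

  agreeBelow-⊞ : ∀ {D A A′ B B′} → AgreeBelow D A A′ → AgreeBelow D B B′ → AgreeBelow D (A ⊞ B) (A′ ⊞ B′)
  agreeBelow-⊞ A~A′ B~B′ i j d = cong₂ ℤ._+_ (A~A′ i j d) (B~B′ i j d)

  ⊠-local : ∀ i j (F F′ G G′ : PS) →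
            (∀ a b → a ≤ i → b ≤ j → F a b ≡ F′ a b) → (∀ a b → a ≤ i → b ≤ j → G a b ≡ G′ a b) →
            (F ⊠ G) i j ≡ (F′ ⊠ G′) i j
  ⊠-local zero j F F′ G G′ F≡ G≡ =
    ℤ[[z]].*ₛ-local j (F 0) (F′ 0) (G 0) (G′ 0) (λ b → F≡ 0 b z≤n) (λ b → G≡ 0 b z≤n)
  ⊠-local (suc i) j F F′ G G′ F≡ G≡ = cong₂ ℤ._+_
    (ℤ[[z]].*ₛ-local j (F 0) (F′ 0) (G (suc i)) (G′ (suc i)) (λ b → F≡ 0 b z≤n) (λ b → G≡ (suc i) b ℕP.≤-refl))
    (⊠-local i j (ℤ[[y,z]].shift F) (ℤ[[y,z]].shift F′) G G′
      (λ a b a≤i b≤j → F≡ (suc a) b (s≤s a≤i) b≤j) (λ a b a≤i b≤j → G≡ a b (ℕP.m≤n⇒m≤1+n a≤i) b≤j))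

  agreeBelow-⊠ : ∀ {D A A′ B B′} → AgreeBelow D A A′ → AgreeBelow D B B′ → AgreeBelow D (A ⊠ B) (A′ ⊠ B′)
  agreeBelow-⊠ {A = A} {A′} {B} {B′} A~A′ B~B′ i j d = ⊠-local i j A A′ B B′
    (λ a b a≤i b≤j → A~A′ a b (ℕP.≤-<-trans (ℕP.+-mono-≤ a≤i b≤j) d))
    (λ a b a≤i b≤j → B~B′ a b (ℕP.≤-<-trans (ℕP.+-mono-≤ a≤i b≤j) d))

  agreeBelow-yS⊠ : ∀ {D A A′} → AgreeBelow D A A′ → AgreeBelow (suc D) (yS ⊠ A) (yS ⊠ A′)
  agreeBelow-yS⊠ {A = A} {A′} A~A′ zero j d = trans (yS⊠-zero A j) (sym (yS⊠-zero A′ j))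
  agreeBelow-yS⊠ {A = A} {A′} A~A′ (suc i) j (s≤s d) = trans (yS⊠-suc A i j) (trans (A~A′ i j d) (sym (yS⊠-suc A′ i j)))

  agreeBelow-zS⊠ : ∀ {D A A′} → AgreeBelow D A A′ → AgreeBelow (suc D) (zS ⊠ A) (zS ⊠ A′)
  agreeBelow-zS⊠ {A = A} {A′} A~A′ i zero d = trans (zS⊠-zero A i) (sym (zS⊠-zero A′ i))
  agreeBelow-zS⊠ {D} {A} {A′} A~A′ i (suc j) d =
    trans (zS⊠-suc A i j) (trans (A~A′ i j (ℕP.≤-pred (subst (_< suc D) (ℕP.+-suc i j) d))) (sym (zS⊠-suc A′ i j)))

module WalkPairs where

  open import Defs
  open import Data.Bool as Bool using (Bool; true; false; _∨_)
  import Data.Bool.Properties as BoolP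
  open import Data.Nat as ℕ using (ℕ; zero; suc; _+_; _*_; _≡ᵇ_; _≤_; _<_; z≤n; s≤s)
  import Data.Nat.Properties as ℕP
  open import Data.Integer as ℤ using (ℤ; +[1+_]; -[1+_])
  open import Data.List using (List; []; _∷_; _++_; _∷ʳ_; map; filter; length; concatMap; drop; reverse)
  import Data.List.Properties as ListP
  open import Data.List.Relation.Unary.All as All using (All; []; _∷_)
  open import Data.List.Relation.Unary.All.Properties using (∷ʳ⁺)
  open import Data.List.Relation.Unary.Any using (any?)
  open import Data.Vec using ([]; _∷_; count)
  open import Data.Product using (_×_; _,_; proj₁)
  open import Relation.Binary.PropositionalEquality using (_≡_; _≢_; refl; sym; trans; cong; cong₂; subst; subst₂; module ≡-Reasoning)
  open import Relation.Nullary using (Dec; does; yes; no)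
  open import Relation.Nullary.Decidable using (dec-true; dec-false)
  open import Algebra.Properties.CommutativeSemigroup ℕP.+-commutativeSemigroup using (interchange)

  [_] : Bool → ℕ
  [ true ] = 1
  [ false ] = 0

  eastSteps : ∀ {n} → Walk n → ℕ
  eastSteps w = count (λ b → b Bool.≟ true) w

  module _ {A : Set} where

    ∑ : List A → (A → ℕ) → ℕ
    ∑ [] h = 0
    ∑ (x ∷ xs) h = h x + ∑ xs h

    syntax ∑ xs (λ x → e) = ∑[ x ∈ xs ] e

    ∑-cong : ∀ xs {h g : A → ℕ} → (∀ x → h x ≡ g x) → ∑ xs h ≡ ∑ xs g
    ∑-cong [] h≗g = refl
    ∑-cong (x ∷ xs) h≗g = cong₂ _+_ (h≗g x) (∑-cong xs h≗g)

    ∑-zero : ∀ xs {h : A → ℕ} → (∀ x → h x ≡ 0) → ∑ xs h ≡ 0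
    ∑-zero [] h≗0 = refl
    ∑-zero (x ∷ xs) h≗0 = cong₂ _+_ (h≗0 x) (∑-zero xs h≗0)

    ∑-+ : ∀ xs (h g : A → ℕ) → ∑[ x ∈ xs ] (h x + g x) ≡ ∑ xs h + ∑ xs g
    ∑-+ [] h g = refl
    ∑-+ (x ∷ xs) h g = trans (cong (h x + g x +_) (∑-+ xs h g)) (interchange (h x) (g x) _ _)

    ∑-*-distribˡ-+ : ∀ xs (a h g : A → ℕ) →
                     ∑[ x ∈ xs ] (a x * (h x + g x)) ≡ ∑[ x ∈ xs ] (a x * h x) + ∑[ x ∈ xs ] (a x * g x)
    ∑-*-distribˡ-+ xs a h g = trans (∑-cong xs (λ x → ℕP.*-distribˡ-+ (a x) (h x) (g x))) (∑-+ xs _ _)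

    ∑-++ : ∀ xs ys (h : A → ℕ) → ∑ (xs ++ ys) h ≡ ∑ xs h + ∑ ys h
    ∑-++ [] ys h = refl
    ∑-++ (x ∷ xs) ys h = trans (cong (h x +_) (∑-++ xs ys h)) (sym (ℕP.+-assoc (h x) _ _))

    ∑-filter : ∀ {p} {P : A → Set p} (P? : ∀ x → Dec (P x)) xs h →
               ∑ (filter P? xs) h ≡ ∑[ x ∈ xs ] ([ does (P? x) ] * h x)
    ∑-filter P? [] h = refl
    ∑-filter P? (x ∷ xs) h with does (P? x)
    ... | true = cong₂ _+_ (sym (ℕP.+-identityʳ (h x))) (∑-filter P? xs h)
    ... | false = ∑-filter P? xs h

    length-filter≡∑ : ∀ {p} {P : A → Set p} (P? : ∀ x → Dec (P x)) xs →
                      length (filter P? xs) ≡ ∑[ x ∈ xs ] [ does (P? x) ]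
    length-filter≡∑ P? [] = refl
    length-filter≡∑ P? (x ∷ xs) with does (P? x)
    ... | true = cong suc (length-filter≡∑ P? xs)
    ... | false = length-filter≡∑ P? xs

  ∑-concatMap : ∀ {A B : Set} (f : A → List B) xs h → ∑ (concatMap f xs) h ≡ ∑[ x ∈ xs ] ∑ (f x) h
  ∑-concatMap f [] h = refl
  ∑-concatMap f (x ∷ xs) h = trans (∑-++ (f x) (concatMap f xs) h) (cong (∑ (f x) h +_) (∑-concatMap f xs h))

  ∑-map : ∀ {A B : Set} (f : A → B) xs h → ∑ (map f xs) h ≡ ∑[ x ∈ xs ] h (f x)
  ∑-map f [] h = refl
  ∑-map f (x ∷ xs) h = cong (h (f x) +_) (∑-map f xs h)

  ∑-allWalks : ∀ n (h : Walk (suc n) → ℕ) → ∑ (allWalks (suc n)) h ≡ ∑[ w ∈ allWalks n ] (h (true ∷ w) + h (false ∷ w))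
  ∑-allWalks n h = trans (∑-concatMap _ (allWalks n) h)
    (∑-cong (allWalks n) (λ w → cong (h (true ∷ w) +_) (ℕP.+-identityʳ _)))

  N-as-∑ : ∀ k n r → N k n r ≡ ∑[ w₁ ∈ allWalks n ] ([ eastSteps w₁ ≡ᵇ r ] *
                                 ∑[ w₂ ∈ allWalks n ] ([ eastSteps w₂ ≡ᵇ r ] * [ intersections w₁ w₂ ≡ᵇ k ]))
  N-as-∑ k n r = begin
    N k n r
      ≡⟨ length-filter≡∑ _ (concatMap (λ w₁ → map (w₁ ,_) W) W) ⟩
    ∑ (concatMap (λ w₁ → map (w₁ ,_) W) W) hits
      ≡⟨ ∑-concatMap _ W hits ⟩
    ∑[ w₁ ∈ W ] ∑ (map (w₁ ,_) W) hits
      ≡⟨ ∑-cong W (λ w₁ → trans (∑-map _ W hits) (∑-filter _ (allWalks n) _)) ⟩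
    ∑[ w₁ ∈ W ] ∑[ w₂ ∈ allWalks n ] ([ eastSteps w₂ ≡ᵇ r ] * [ intersections w₁ w₂ ≡ᵇ k ])
      ≡⟨ ∑-filter _ (allWalks n) _ ⟩
    _ ∎
    where
    open ≡-Reasoning
    W = walksTo n r
    hits : Walk n × Walk n → ℕ
    hits (w₁ , w₂) = [ intersections w₁ w₂ ≡ᵇ k ]

  -- m ⊖ n, but by structural recursion so that it computes on open terms.
  offset : ℕ → ℕ → ℤ
  offset zero zero = ℤ.+ 0
  offset zero (suc n) = -[1+ n ]
  offset (suc m) zero = +[1+ m ]
  offset (suc m) (suc n) = offset m n

  isZero : ℤ → Bool
  isZero (ℤ.+ zero) = true
  isZero _ = false

  -- The offset d of two walks after equally many steps is 0 exactly when they are at the same point.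
  step : ℤ → Bool → Bool → ℤ
  step d true true = d
  step d true false = ℤ.suc d
  step d false true = ℤ.pred d
  step d false false = d

  meetings : ∀ {n} → ℤ → Walk n → Walk n → ℕ
  meetings d [] [] = 0
  meetings d (b₁ ∷ w₁) (b₂ ∷ w₂) = [ isZero d ] + meetings (step d b₁ b₂) w₁ w₂

  endsTogether : ∀ {n} → ℤ → Walk n → Walk n → Bool
  endsTogether d [] [] = isZero d
  endsTogether d (b₁ ∷ w₁) (b₂ ∷ w₂) = endsTogether (step d b₁ b₂) w₁ w₂

  suc-offset : ∀ m n → ℤ.suc (offset m n) ≡ offset (suc m) n
  suc-offset zero zero = refl
  suc-offset zero (suc zero) = refl
  suc-offset zero (suc (suc n)) = refl
  suc-offset (suc m) zero = refl
  suc-offset (suc m) (suc n) = suc-offset m n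

  pred-offset : ∀ m n → ℤ.pred (offset m n) ≡ offset m (suc n)
  pred-offset zero zero = refl
  pred-offset zero (suc n) = refl
  pred-offset (suc zero) zero = refl
  pred-offset (suc (suc m)) zero = refl
  pred-offset (suc m) (suc n) = pred-offset m n

  isZero-offset : ∀ m n → isZero (offset m n) ≡ (m ≡ᵇ n)
  isZero-offset zero zero = refl
  isZero-offset zero (suc n) = refl
  isZero-offset (suc m) zero = refl
  isZero-offset (suc m) (suc n) = isZero-offset m n

  endsTogether-offset : ∀ {n} a₁ a₂ (w₁ w₂ : Walk n) →
                        endsTogether (offset a₁ a₂) w₁ w₂ ≡ (a₁ + eastSteps w₁ ≡ᵇ a₂ + eastSteps w₂)
  endsTogether-offset a₁ a₂ [] [] =
    trans (isZero-offset a₁ a₂) (sym (cong₂ _≡ᵇ_ (ℕP.+-identityʳ a₁) (ℕP.+-identityʳ a₂)))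
  endsTogether-offset a₁ a₂ (true ∷ w₁) (true ∷ w₂) =
    trans (endsTogether-offset (suc a₁) (suc a₂) w₁ w₂) (sym (cong₂ _≡ᵇ_ (ℕP.+-suc a₁ _) (ℕP.+-suc a₂ _)))
  endsTogether-offset a₁ a₂ (true ∷ w₁) (false ∷ w₂) =
    trans (cong (λ d → endsTogether d w₁ w₂) (suc-offset a₁ a₂))
      (trans (endsTogether-offset (suc a₁) a₂ w₁ w₂) (sym (cong (_≡ᵇ a₂ + eastSteps w₂) (ℕP.+-suc a₁ _))))
  endsTogether-offset a₁ a₂ (false ∷ w₁) (true ∷ w₂) =
    trans (cong (λ d → endsTogether d w₁ w₂) (pred-offset a₁ a₂))
      (trans (endsTogether-offset a₁ (suc a₂) w₁ w₂) (sym (cong (a₁ + eastSteps w₁ ≡ᵇ_) (ℕP.+-suc a₂ _))))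
  endsTogether-offset a₁ a₂ (false ∷ w₁) (false ∷ w₂) = endsTogether-offset a₁ a₂ w₁ w₂

  level : Point → ℕ
  level (a , b) = a + b

  advance : Point → Bool → Point
  advance (a , b) true = (suc a , b)
  advance (a , b) false = (a , suc b)

  level-advance : ∀ p b → level (advance p b) ≡ suc (level p)
  level-advance (a , b) true = refl
  level-advance (a , b) false = ℕP.+-suc a b

  offset-advance : ∀ p₁ p₂ b₁ b₂ →
                   offset (proj₁ (advance p₁ b₁)) (proj₁ (advance p₂ b₂)) ≡ step (offset (proj₁ p₁) (proj₁ p₂)) b₁ b₂
  offset-advance (a₁ , _) (a₂ , _) true true = refl
  offset-advance (a₁ , _) (a₂ , _) true false = sym (suc-offset a₁ a₂)
  offset-advance (a₁ , _) (a₂ , _) false true = sym (pred-offset a₁ a₂)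
  offset-advance (a₁ , _) (a₂ , _) false false = refl

  pointsFrom-∷ : ∀ {n} p b (w : Walk n) → pointsFrom p (b ∷ w) ≡ p ∷ pointsFrom (advance p b) w
  pointsFrom-∷ p true w = refl
  pointsFrom-∷ p false w = refl

  levels-pointsFrom : ∀ {n} p (w : Walk n) → All (λ q → level p ≤ level q) (pointsFrom p w)
  levels-pointsFrom p [] = ℕP.≤-refl ∷ []
  levels-pointsFrom p (b ∷ w) rewrite pointsFrom-∷ p b w =
    ℕP.≤-refl ∷ All.map (λ {q} le → ℕP.≤-trans (ℕP.n≤1+n (level p)) (subst (_≤ level q) (level-advance p b) le))
                        (levels-pointsFrom (advance p b) w)

  dropLast : ∀ {A : Set} → List A → List A
  dropLast [] = []
  dropLast (x ∷ []) = []
  dropLast (x ∷ y ∷ ys) = x ∷ dropLast (y ∷ ys)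

  reverse-drop-reverse : ∀ {A : Set} (xs : List A) → reverse (drop 1 (reverse xs)) ≡ dropLast xs
  reverse-drop-reverse [] = refl
  reverse-drop-reverse (x ∷ []) = refl
  reverse-drop-reverse (x ∷ y ∷ ys) = begin
    reverse (drop 1 (reverse (x ∷ y ∷ ys)))
      ≡⟨ cong (λ zs → reverse (drop 1 zs)) (trans (ListP.unfold-reverse x (y ∷ ys)) (cong (_∷ʳ x) (ListP.unfold-reverse y ys))) ⟩
    reverse (drop 1 ((reverse ys ∷ʳ y) ∷ʳ x))
      ≡⟨ cong reverse (drop-∷ʳ (reverse ys)) ⟩
    reverse (drop 1 (reverse ys ∷ʳ y) ∷ʳ x)
      ≡⟨ ListP.reverse-++ (drop 1 (reverse ys ∷ʳ y)) (x ∷ []) ⟩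
    x ∷ reverse (drop 1 (reverse ys ∷ʳ y))
      ≡⟨ cong (λ zs → x ∷ reverse (drop 1 zs)) (sym (ListP.unfold-reverse y ys)) ⟩
    x ∷ reverse (drop 1 (reverse (y ∷ ys)))
      ≡⟨ cong (x ∷_) (reverse-drop-reverse (y ∷ ys)) ⟩
    x ∷ dropLast (y ∷ ys) ∎
    where
    open ≡-Reasoning
    drop-∷ʳ : ∀ zs → drop 1 ((zs ∷ʳ y) ∷ʳ x) ≡ drop 1 (zs ∷ʳ y) ∷ʳ x
    drop-∷ʳ [] = refl
    drop-∷ʳ (z ∷ zs) = refl

  dropLast-∷-pointsFrom : ∀ {n} x p (w : Walk n) → dropLast (x ∷ pointsFrom p w) ≡ x ∷ dropLast (pointsFrom p w)
  dropLast-∷-pointsFrom x p [] = refl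
  dropLast-∷-pointsFrom x p (true ∷ w) = refl
  dropLast-∷-pointsFrom x p (false ∷ w) = refl

  _∈ᵇ_ : Point → List Point → Bool
  p ∈ᵇ L = does (any? (p ≟P_) L)

  ∈ᵇ-++ : ∀ p xs ys → p ∈ᵇ (xs ++ ys) ≡ p ∈ᵇ xs ∨ p ∈ᵇ ys
  ∈ᵇ-++ p [] ys = refl
  ∈ᵇ-++ p (x ∷ xs) ys = trans (cong (does (p ≟P x) ∨_) (∈ᵇ-++ p xs ys)) (sym (BoolP.∨-assoc (does (p ≟P x)) _ _))

  ∉ᵇ-other-levels : ∀ p L → All (λ q → level q ≢ level p) L → p ∈ᵇ L ≡ false
  ∉ᵇ-other-levels p [] [] = refl
  ∉ᵇ-other-levels p (q ∷ L) (q≢p ∷ L≢p) =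
    cong₂ _∨_ (dec-false (p ≟P q) (λ p≡q → q≢p (cong level (sym p≡q)))) (∉ᵇ-other-levels p L L≢p)

  ≟P-same-level : ∀ p q → level p ≡ level q → does (p ≟P q) ≡ does (proj₁ p ℕ.≟ proj₁ q)
  ≟P-same-level (a , b) (a′ , b′) a+b≡a′+b′ = compare (a ℕ.≟ a′)
    where
    compare : Dec (a ≡ a′) → does ((a , b) ≟P (a′ , b′)) ≡ does (a ℕ.≟ a′)
    compare (yes refl) = trans (dec-true ((a , b) ≟P (a , b′)) (cong (a ,_) (ℕP.+-cancelˡ-≡ a b b′ a+b≡a′+b′)))
                               (sym (dec-true (a ℕ.≟ a) refl))
    compare (no a≢a′) = trans (dec-false ((a , b) ≟P (a′ , b′)) (λ eq → a≢a′ (cong proj₁ eq)))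
                              (sym (dec-false (a ℕ.≟ a′) a≢a′))

  countIn : List Point → List Point → ℕ
  countIn L xs = length (filter (λ p → any? (p ≟P_) L) xs)

  countIn-∷ : ∀ L x xs → countIn L (x ∷ xs) ≡ [ x ∈ᵇ L ] + countIn L xs
  countIn-∷ L x xs with does (any? (x ≟P_) L)
  ... | true = refl
  ... | false = refl

  -- At equal levels, the point p₁ of the first walk can only meet the second walk at p₂.
  meets-at : ∀ {n} p₁ p₂ b₂ (w₂ : Walk n) X → level p₁ ≡ level p₂ → All (λ q → level q < level p₁) X →
             p₁ ∈ᵇ (X ++ p₂ ∷ pointsFrom (advance p₂ b₂) w₂) ≡ isZero (offset (proj₁ p₁) (proj₁ p₂))
  meets-at p₁ p₂ b₂ w₂ X same X<p₁ = begin
    p₁ ∈ᵇ (X ++ p₂ ∷ pointsFrom (advance p₂ b₂) w₂)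
      ≡⟨ ∈ᵇ-++ p₁ X _ ⟩
    p₁ ∈ᵇ X ∨ (does (p₁ ≟P p₂) ∨ p₁ ∈ᵇ pointsFrom (advance p₂ b₂) w₂)
      ≡⟨ cong₂ (λ u v → u ∨ (does (p₁ ≟P p₂) ∨ v))
               (∉ᵇ-other-levels p₁ X (All.map ℕP.<⇒≢ X<p₁)) (∉ᵇ-other-levels p₁ _ later) ⟩
    does (p₁ ≟P p₂) ∨ false
      ≡⟨ BoolP.∨-identityʳ _ ⟩
    does (p₁ ≟P p₂)
      ≡⟨ ≟P-same-level p₁ p₂ same ⟩
    (proj₁ p₁ ≡ᵇ proj₁ p₂)
      ≡⟨ sym (isZero-offset (proj₁ p₁) (proj₁ p₂)) ⟩
    isZero (offset (proj₁ p₁) (proj₁ p₂)) ∎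
    where
    open ≡-Reasoning
    later : All (λ q → level q ≢ level p₁) (pointsFrom (advance p₂ b₂) w₂)
    later = All.map (λ le q≡p₁ → ℕP.n≮n _ (subst₂ _≤_ (trans (level-advance p₂ b₂) (cong suc (sym same))) q≡p₁ le))
                    (levels-pointsFrom (advance p₂ b₂) w₂)

  countIn-pointsFrom : ∀ {n} (w₁ w₂ : Walk n) p₁ p₂ X → level p₁ ≡ level p₂ → All (λ q → level q < level p₁) X →
                       countIn (X ++ pointsFrom p₂ w₂) (dropLast (pointsFrom p₁ w₁)) ≡ meetings (offset (proj₁ p₁) (proj₁ p₂)) w₁ w₂
  countIn-pointsFrom [] [] p₁ p₂ X same X<p₁ = refl
  countIn-pointsFrom (b₁ ∷ w₁) (b₂ ∷ w₂) p₁ p₂ X same X<p₁ = begin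
    countIn (X ++ pointsFrom p₂ (b₂ ∷ w₂)) (dropLast (pointsFrom p₁ (b₁ ∷ w₁)))
      ≡⟨ cong₂ (λ L xs → countIn (X ++ L) (dropLast xs)) (pointsFrom-∷ p₂ b₂ w₂) (pointsFrom-∷ p₁ b₁ w₁) ⟩
    countIn (X ++ p₂ ∷ rest₂) (dropLast (p₁ ∷ rest₁))
      ≡⟨ cong (countIn (X ++ p₂ ∷ rest₂)) (dropLast-∷-pointsFrom p₁ (advance p₁ b₁) w₁) ⟩
    countIn (X ++ p₂ ∷ rest₂) (p₁ ∷ dropLast rest₁)
      ≡⟨ countIn-∷ (X ++ p₂ ∷ rest₂) p₁ (dropLast rest₁) ⟩
    [ p₁ ∈ᵇ (X ++ p₂ ∷ rest₂) ] + countIn (X ++ p₂ ∷ rest₂) (dropLast rest₁)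
      ≡⟨ cong₂ _+_ (cong [_] (meets-at p₁ p₂ b₂ w₂ X same X<p₁))
                   (cong (λ L → countIn L (dropLast rest₁)) (sym (ListP.++-assoc X (p₂ ∷ []) rest₂))) ⟩
    [ isZero d ] + countIn ((X ∷ʳ p₂) ++ rest₂) (dropLast rest₁)
      ≡⟨ cong ([ isZero d ] +_) (countIn-pointsFrom w₁ w₂ (advance p₁ b₁) (advance p₂ b₂) (X ∷ʳ p₂) same′ X′<p₁′) ⟩
    [ isZero d ] + meetings (offset (proj₁ (advance p₁ b₁)) (proj₁ (advance p₂ b₂))) w₁ w₂
      ≡⟨ cong (λ d′ → [ isZero d ] + meetings d′ w₁ w₂) (offset-advance p₁ p₂ b₁ b₂) ⟩
    meetings d (b₁ ∷ w₁) (b₂ ∷ w₂) ∎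
    where
    open ≡-Reasoning
    d = offset (proj₁ p₁) (proj₁ p₂)
    rest₁ = pointsFrom (advance p₁ b₁) w₁
    rest₂ = pointsFrom (advance p₂ b₂) w₂
    same′ : level (advance p₁ b₁) ≡ level (advance p₂ b₂)
    same′ = trans (level-advance p₁ b₁) (trans (cong suc same) (sym (level-advance p₂ b₂)))
    X′<p₁′ : All (λ q → level q < level (advance p₁ b₁)) (X ∷ʳ p₂)
    X′<p₁′ = subst (λ t → All (λ q → level q < t) (X ∷ʳ p₂)) (sym (level-advance p₁ b₁))
                   (∷ʳ⁺ (All.map ℕP.m<n⇒m<1+n X<p₁) (ℕP.≤-reflexive (cong suc (sym same))))

  meetings≡suc-intersections : ∀ {m} (w₁ w₂ : Walk (suc m)) → meetings (ℤ.+ 0) w₁ w₂ ≡ suc (intersections w₁ w₂)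
  meetings≡suc-intersections (b₁ ∷ w₁) (b₂ ∷ w₂) = cong suc (sym (begin
    intersections (b₁ ∷ w₁) (b₂ ∷ w₂)
      ≡⟨ cong₂ (λ L xs → countIn L (drop 1 xs)) (pointsFrom-∷ o b₂ w₂) (reverse-drop-reverse (points (b₁ ∷ w₁))) ⟩
    countIn (o ∷ rest₂) (drop 1 (dropLast (pointsFrom o (b₁ ∷ w₁))))
      ≡⟨ cong (λ xs → countIn (o ∷ rest₂) (drop 1 (dropLast xs))) (pointsFrom-∷ o b₁ w₁) ⟩
    countIn (o ∷ rest₂) (drop 1 (dropLast (o ∷ rest₁)))
      ≡⟨ cong (λ xs → countIn (o ∷ rest₂) (drop 1 xs)) (dropLast-∷-pointsFrom o (advance o b₁) w₁) ⟩
    countIn (o ∷ rest₂) (dropLast rest₁)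
      ≡⟨ countIn-pointsFrom w₁ w₂ (advance o b₁) (advance o b₂) (o ∷ [])
           (trans (level-advance o b₁) (sym (level-advance o b₂)))
           (subst (0 <_) (sym (level-advance o b₁)) (s≤s z≤n) ∷ []) ⟩
    meetings (offset (proj₁ (advance o b₁)) (proj₁ (advance o b₂))) w₁ w₂
      ≡⟨ cong (λ d → meetings d w₁ w₂) (offset-advance o o b₁ b₂) ⟩
    meetings (step (ℤ.+ 0) b₁ b₂) w₁ w₂ ∎))
    where
    open ≡-Reasoning
    o : Point
    o = (0 , 0)
    rest₁ = pointsFrom (advance o b₁) w₁
    rest₂ = pointsFrom (advance o b₂) w₂

  partners : ∀ n → ℤ → Walk n → ℕ → ℕ
  partners n d w₁ k = ∑[ w₂ ∈ allWalks n ] ([ endsTogether d w₁ w₂ ] * [ meetings d w₁ w₂ ≡ᵇ k ])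

  pairSum : ℕ → ℤ → ℕ → ℕ → ℕ
  pairSum n d r k = ∑[ w₁ ∈ allWalks n ] ([ eastSteps w₁ ≡ᵇ r ] * partners n d w₁ k)

  firstStep : (ℤ → ℕ → ℕ → ℕ) → ℤ → ℕ → ℕ → ℕ
  firstStep c d zero k = c (ℤ.pred d) zero k + c d zero k
  firstStep c d (suc r) k = (c d r k + c (ℤ.suc d) r k) + (c (ℤ.pred d) (suc r) k + c d (suc r) k)

  -- A meeting at the current point (offset 0) is counted before the step is taken.
  pairCount : ℕ → ℤ → ℕ → ℕ → ℕ
  pairCount zero d r k = [ 0 ≡ᵇ r ] * ([ isZero d ] * [ 0 ≡ᵇ k ])
  pairCount (suc m) (ℤ.+ zero) r zero = 0
  pairCount (suc m) (ℤ.+ zero) r (suc k) = firstStep (pairCount m) (ℤ.+ 0) r k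
  pairCount (suc m) +[1+ e ] r k = firstStep (pairCount m) +[1+ e ] r k
  pairCount (suc m) -[1+ e ] r k = firstStep (pairCount m) -[1+ e ] r k

  +-≡ᵇ-cancelˡ : ∀ a m n → (a + m ≡ᵇ a + n) ≡ (m ≡ᵇ n)
  +-≡ᵇ-cancelˡ zero m n = refl
  +-≡ᵇ-cancelˡ (suc a) m n = +-≡ᵇ-cancelˡ a m n

  ≡ᵇ-comm : ∀ m n → (m ≡ᵇ n) ≡ (n ≡ᵇ m)
  ≡ᵇ-comm zero zero = refl
  ≡ᵇ-comm zero (suc n) = refl
  ≡ᵇ-comm (suc m) zero = refl
  ≡ᵇ-comm (suc m) (suc n) = ≡ᵇ-comm m n

  [≡ᵇ]*-cong : ∀ x r {X Y} → (x ≡ r → X ≡ Y) → [ x ≡ᵇ r ] * X ≡ [ x ≡ᵇ r ] * Y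
  [≡ᵇ]*-cong x r X≡Y with x ≡ᵇ r in eq
  ... | true = cong (1 *_) (X≡Y (ℕP.≡ᵇ⇒≡ x r (subst Bool.T (sym eq) _)))
  ... | false = refl

  partners-step : ∀ m d k b (w₁ : Walk m) →
                  partners (suc m) d (b ∷ w₁) ([ isZero d ] + k) ≡ partners m (step d b true) w₁ k + partners m (step d b false) w₁ k
  partners-step m d k b w₁ = trans (∑-allWalks m _)
    (trans (∑-cong (allWalks m) (λ w₂ → cong₂ _+_ (after true w₂) (after false w₂))) (∑-+ (allWalks m) _ _))
    where
    after : ∀ b₂ w₂ → [ endsTogether (step d b b₂) w₁ w₂ ] * [ [ isZero d ] + meetings (step d b b₂) w₁ w₂ ≡ᵇ [ isZero d ] + k ]
                    ≡ [ endsTogether (step d b b₂) w₁ w₂ ] * [ meetings (step d b b₂) w₁ w₂ ≡ᵇ k ]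
    after b₂ w₂ = cong (λ t → [ endsTogether (step d b b₂) w₁ w₂ ] * [ t ]) (+-≡ᵇ-cancelˡ [ isZero d ] _ k)

  partners-meeting-now : ∀ m b (w₁ : Walk m) → partners (suc m) (ℤ.+ 0) (b ∷ w₁) 0 ≡ 0
  partners-meeting-now m b w₁ = trans (∑-allWalks m _)
    (∑-zero (allWalks m) (λ w₂ → cong₂ _+_ (ℕP.*-zeroʳ [ endsTogether (step (ℤ.+ 0) b true) w₁ w₂ ])
                                             (ℕP.*-zeroʳ [ endsTogether (step (ℤ.+ 0) b false) w₁ w₂ ])))

  pairSum-step : ∀ m d r k → pairSum (suc m) d r ([ isZero d ] + k) ≡ firstStep (pairSum m) d r k
  pairSum-step m d zero k = begin
    pairSum (suc m) d zero ([ isZero d ] + k)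
      ≡⟨ ∑-allWalks m _ ⟩
    ∑[ w₁ ∈ allWalks m ] ([ eastSteps w₁ ≡ᵇ 0 ] * partners (suc m) d (false ∷ w₁) ([ isZero d ] + k))
      ≡⟨ ∑-cong (allWalks m) (λ w₁ → cong ([ eastSteps w₁ ≡ᵇ 0 ] *_) (partners-step m d k false w₁)) ⟩
    ∑[ w₁ ∈ allWalks m ] ([ eastSteps w₁ ≡ᵇ 0 ] * (partners m (ℤ.pred d) w₁ k + partners m d w₁ k))
      ≡⟨ ∑-*-distribˡ-+ (allWalks m) (λ w₁ → [ eastSteps w₁ ≡ᵇ 0 ]) _ _ ⟩
    firstStep (pairSum m) d zero k ∎
    where open ≡-Reasoning
  pairSum-step m d (suc r) k = begin
    pairSum (suc m) d (suc r) k′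
      ≡⟨ ∑-allWalks m _ ⟩
    ∑[ w₁ ∈ allWalks m ] ([ eastSteps w₁ ≡ᵇ r ] * partners (suc m) d (true ∷ w₁) k′
                          + [ eastSteps w₁ ≡ᵇ suc r ] * partners (suc m) d (false ∷ w₁) k′)
      ≡⟨ ∑-cong (allWalks m) (λ w₁ → cong₂ (λ u v → [ eastSteps w₁ ≡ᵇ r ] * u + [ eastSteps w₁ ≡ᵇ suc r ] * v)
                                            (partners-step m d k true w₁) (partners-step m d k false w₁)) ⟩
    ∑[ w₁ ∈ allWalks m ] ([ eastSteps w₁ ≡ᵇ r ] * (partners m d w₁ k + partners m (ℤ.suc d) w₁ k)
                          + [ eastSteps w₁ ≡ᵇ suc r ] * (partners m (ℤ.pred d) w₁ k + partners m d w₁ k))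
      ≡⟨ ∑-+ (allWalks m) _ _ ⟩
    ∑[ w₁ ∈ allWalks m ] ([ eastSteps w₁ ≡ᵇ r ] * (partners m d w₁ k + partners m (ℤ.suc d) w₁ k))
      + ∑[ w₁ ∈ allWalks m ] ([ eastSteps w₁ ≡ᵇ suc r ] * (partners m (ℤ.pred d) w₁ k + partners m d w₁ k))
      ≡⟨ cong₂ _+_ (∑-*-distribˡ-+ (allWalks m) (λ w₁ → [ eastSteps w₁ ≡ᵇ r ]) _ _)
                   (∑-*-distribˡ-+ (allWalks m) (λ w₁ → [ eastSteps w₁ ≡ᵇ suc r ]) _ _) ⟩
    firstStep (pairSum m) d (suc r) k ∎
    where
    open ≡-Reasoning
    k′ = [ isZero d ] + k

  pairSum-meeting-now : ∀ m r → pairSum (suc m) (ℤ.+ 0) r 0 ≡ 0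
  pairSum-meeting-now m r = trans (∑-allWalks m _) (∑-zero (allWalks m) (λ w₁ → cong₂ _+_
    (trans (cong ([ suc (eastSteps w₁) ≡ᵇ r ] *_) (partners-meeting-now m true w₁)) (ℕP.*-zeroʳ [ suc (eastSteps w₁) ≡ᵇ r ]))
    (trans (cong ([ eastSteps w₁ ≡ᵇ r ] *_) (partners-meeting-now m false w₁)) (ℕP.*-zeroʳ [ eastSteps w₁ ≡ᵇ r ]))))

  firstStep-cong : ∀ {c c′} d r k → (∀ d r → c d r k ≡ c′ d r k) → firstStep c d r k ≡ firstStep c′ d r k
  firstStep-cong d zero k c≡c′ = cong₂ _+_ (c≡c′ (ℤ.pred d) 0) (c≡c′ d 0)
  firstStep-cong d (suc r) k c≡c′ =
    cong₂ _+_ (cong₂ _+_ (c≡c′ d r) (c≡c′ (ℤ.suc d) r)) (cong₂ _+_ (c≡c′ (ℤ.pred d) (suc r)) (c≡c′ d (suc r)))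

  pairSum≡pairCount : ∀ n d r k → pairSum n d r k ≡ pairCount n d r k
  pairSum≡pairCount zero d r k = trans (ℕP.+-identityʳ _) (cong ([ 0 ≡ᵇ r ] *_) (ℕP.+-identityʳ _))
  pairSum≡pairCount (suc m) (ℤ.+ zero) r zero = pairSum-meeting-now m r
  pairSum≡pairCount (suc m) d@(ℤ.+ zero) r (suc k) =
    trans (pairSum-step m d r k) (firstStep-cong d r k (λ d r → pairSum≡pairCount m d r k))
  pairSum≡pairCount (suc m) d@(+[1+ e ]) r k =
    trans (pairSum-step m d r k) (firstStep-cong d r k (λ d r → pairSum≡pairCount m d r k))
  pairSum≡pairCount (suc m) d@(-[1+ e ]) r k =
    trans (pairSum-step m d r k) (firstStep-cong d r k (λ d r → pairSum≡pairCount m d r k))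

  N≡pairCount : ∀ k m r → N k (suc m) r ≡ pairCount (suc m) (ℤ.+ 0) r (suc k)
  N≡pairCount k m r = begin
    N k (suc m) r
      ≡⟨ N-as-∑ k (suc m) r ⟩
    ∑[ w₁ ∈ allWalks (suc m) ] ([ eastSteps w₁ ≡ᵇ r ] *
      ∑[ w₂ ∈ allWalks (suc m) ] ([ eastSteps w₂ ≡ᵇ r ] * [ intersections w₁ w₂ ≡ᵇ k ]))
      ≡⟨ ∑-cong (allWalks (suc m)) (λ w₁ → [≡ᵇ]*-cong (eastSteps w₁) r (λ east≡r →
           ∑-cong (allWalks (suc m)) (λ w₂ → cong₂ _*_ (cong [_] (ends w₁ w₂ east≡r)) (cong [_] (meets w₁ w₂))))) ⟩
    pairSum (suc m) (ℤ.+ 0) r (suc k)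
      ≡⟨ pairSum≡pairCount (suc m) (ℤ.+ 0) r (suc k) ⟩
    pairCount (suc m) (ℤ.+ 0) r (suc k) ∎
    where
    open ≡-Reasoning
    ends : ∀ w₁ w₂ → eastSteps w₁ ≡ r → (eastSteps w₂ ≡ᵇ r) ≡ endsTogether (ℤ.+ 0) w₁ w₂
    ends w₁ w₂ east≡r = sym (trans (endsTogether-offset 0 0 w₁ w₂) (trans (cong (_≡ᵇ eastSteps w₂) east≡r) (≡ᵇ-comm r _)))
    meets : ∀ w₁ w₂ → (intersections w₁ w₂ ≡ᵇ k) ≡ (meetings (ℤ.+ 0) w₁ w₂ ≡ᵇ suc k)
    meets w₁ w₂ = cong (_≡ᵇ suc k) (sym (meetings≡suc-intersections w₁ w₂))

  firstStep-east-overflow : ∀ m d r k → (∀ d′ r′ k′ → m < r′ → pairCount m d′ r′ k′ ≡ 0) →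
                            suc m < r → firstStep (pairCount m) d r k ≡ 0
  firstStep-east-overflow m d (suc r) k overflow (s≤s m<r) =
    cong₂ _+_ (cong₂ _+_ (overflow d r k m<r) (overflow (ℤ.suc d) r k m<r))
              (cong₂ _+_ (overflow (ℤ.pred d) (suc r) k (ℕP.m<n⇒m<1+n m<r)) (overflow d (suc r) k (ℕP.m<n⇒m<1+n m<r)))

  pairCount-east-overflow : ∀ n d r k → n < r → pairCount n d r k ≡ 0
  pairCount-east-overflow zero d (suc r) k n<r = refl
  pairCount-east-overflow (suc m) (ℤ.+ zero) r zero n<r = refl
  pairCount-east-overflow (suc m) d@(ℤ.+ zero) r (suc k) n<r = firstStep-east-overflow m d r k (pairCount-east-overflow m) n<r
  pairCount-east-overflow (suc m) d@(+[1+ e ]) r k n<r = firstStep-east-overflow m d r k (pairCount-east-overflow m) n<r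
  pairCount-east-overflow (suc m) d@(-[1+ e ]) r k n<r = firstStep-east-overflow m d r k (pairCount-east-overflow m) n<r

  pairCount-ahead-allEast : ∀ n e k → pairCount n +[1+ e ] n k ≡ 0
  pairCount-ahead-allEast zero e k = refl
  pairCount-ahead-allEast (suc m) e k =
    cong₂ _+_ (cong₂ _+_ (pairCount-ahead-allEast m e k) (pairCount-ahead-allEast m (suc e) k))
              (cong₂ _+_ (pairCount-east-overflow m _ (suc m) k (ℕP.n<1+n m)) (pairCount-east-overflow m _ (suc m) k (ℕP.n<1+n m)))

  pairCount-behind-allNorth : ∀ n e k → pairCount n -[1+ e ] 0 k ≡ 0
  pairCount-behind-allNorth zero e k = refl
  pairCount-behind-allNorth (suc m) e k = cong₂ _+_ (pairCount-behind-allNorth m (suc e) k) (pairCount-behind-allNorth m e k)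

module PairSeries where

  open import Defs using (PS; yS; zS; N)
  open Bivariate
  open WalkPairs using (N≡pairCount; pairCount; firstStep; pairCount-east-overflow; pairCount-ahead-allEast; pairCount-behind-allNorth)
  open import Data.Nat as ℕ using (ℕ; zero; suc; _∸_; _<_; _≤_; s≤s)
  import Data.Nat.Properties as ℕP
  open import Data.Integer as ℤ using (ℤ; +_; +[1+_]; -[1+_])
  import Data.Integer.Properties as ℤP
  open import Relation.Binary.PropositionalEquality using (_≡_; refl; sym; trans; cong; cong₂)
  open import Relation.Binary.Reasoning.Setoid Ser.setoid
  open import Algebra.Properties.Semiring.Exp Ser.semiring using (_^_)

  pairSeries : ℤ → ℕ → PS
  pairSeries d k i j = + pairCount (i ℕ.+ j) d i k

  pairSeries-firstStep : ∀ d k k′ → (∀ n r → pairCount (suc n) d r k ≡ firstStep (pairCount n) d r k′) → pairCount 0 d 0 k ≡ 0 →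
    pairSeries d k ≋ yS ⊠ (pairSeries d k′ ⊞ pairSeries (ℤ.suc d) k′) ⊞ zS ⊠ (pairSeries (ℤ.pred d) k′ ⊞ pairSeries d k′)
  pairSeries-firstStep d k k′ recursion base = coefficient
    where
    east north : PS
    east = pairSeries d k′ ⊞ pairSeries (ℤ.suc d) k′
    north = pairSeries (ℤ.pred d) k′ ⊞ pairSeries d k′
    both : ℤ → ℤ → ℕ → ℕ → ℕ
    both d₁ d₂ n r = pairCount n d₁ r k′ ℕ.+ pairCount n d₂ r k′
    coefficient : ∀ i j → pairSeries d k i j ≡ (yS ⊠ east ⊞ zS ⊠ north) i j
    coefficient zero zero = trans (cong +_ base) (sym (cong₂ ℤ._+_ (yS⊠-zero east 0) (zS⊠-zero north 0)))
    coefficient zero (suc j) =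
      trans (cong +_ (recursion j 0)) (sym (trans (cong₂ ℤ._+_ (yS⊠-zero east (suc j)) (zS⊠-suc north 0 j)) (ℤP.+-identityˡ _)))
    coefficient (suc i) zero =
      trans (cong +_ (trans (recursion (i ℕ.+ 0) (suc i)) (cong (both d (ℤ.suc d) (i ℕ.+ 0) i ℕ.+_) northOverflow)))
            (sym (cong₂ ℤ._+_ (yS⊠-suc east i 0) (zS⊠-zero north (suc i))))
      where
      i+0<1+i : i ℕ.+ 0 < suc i
      i+0<1+i = s≤s (ℕP.≤-reflexive (ℕP.+-identityʳ i))
      northOverflow : both (ℤ.pred d) d (i ℕ.+ 0) (suc i) ≡ 0
      northOverflow = cong₂ ℕ._+_ (pairCount-east-overflow _ _ _ _ i+0<1+i) (pairCount-east-overflow _ _ _ _ i+0<1+i)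
    coefficient (suc i) (suc j) =
      trans (cong +_ (trans (recursion (i ℕ.+ suc j) (suc i))
                            (cong (λ n → both d (ℤ.suc d) (i ℕ.+ suc j) i ℕ.+ both (ℤ.pred d) d n (suc i)) (ℕP.+-suc i j))))
            (sym (cong₂ ℤ._+_ (yS⊠-suc east i (suc j)) (zS⊠-suc north (suc i) j)))

  pairSeries-00 : pairSeries (+ 0) 0 ≋ 𝟙
  pairSeries-00 zero zero = refl
  pairSeries-00 zero (suc j) = refl
  pairSeries-00 (suc i) j = refl

  -- Cutting a pair of walks at the first time the offset drops from e + 1 to e shows
  -- U (e + 1) k = U 1 0 ⊠ U e k; both sides satisfy the same recursion, so they agree in every degree.
  module FirstPassage (w t : PS)
    (agreeBelow-w⊠ : ∀ {D A A′} → AgreeBelow D A A′ → AgreeBelow (suc D) (w ⊠ A) (w ⊠ A′))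
    (agreeBelow-t⊠ : ∀ {D A A′} → AgreeBelow D A A′ → AgreeBelow (suc D) (t ⊠ A) (t ⊠ A′))
    (U : ℕ → ℕ → PS)
    (U-firstStep : ∀ e k → U (suc e) k ≋ w ⊠ (U (suc e) k ⊞ U (suc (suc e)) k) ⊞ t ⊠ (U e k ⊞ U (suc e) k))
    (U-00 : U 0 0 ≋ 𝟙)
    where

    Q : PS
    Q = U 1 0

    Q⊠-firstStep : ∀ X → Q ⊠ X ≋ w ⊠ (Q ⊠ X ⊞ U 2 0 ⊠ X) ⊞ t ⊠ (X ⊞ Q ⊠ X)
    Q⊠-firstStep X = begin
      Q ⊠ X
        ≈⟨ Ser.*-cong (U-firstStep 0 0) (Ser.refl {X}) ⟩
      (w ⊠ (Q ⊞ U 2 0) ⊞ t ⊠ (U 0 0 ⊞ Q)) ⊠ X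
        ≈⟨ distribute w t Q (U 2 0) (U 0 0) Q X ⟩
      w ⊠ (Q ⊠ X ⊞ U 2 0 ⊠ X) ⊞ t ⊠ (U 0 0 ⊠ X ⊞ Q ⊠ X)
        ≈⟨ Ser.+-cong (Ser.refl {w ⊠ (Q ⊠ X ⊞ U 2 0 ⊠ X)})
                      (Ser.*-cong (Ser.refl {t}) (Ser.+-cong (Ser.trans (Ser.*-cong U-00 (Ser.refl {X})) (Ser.*-identityˡ X)) (Ser.refl {Q ⊠ X}))) ⟩
      w ⊠ (Q ⊠ X ⊞ U 2 0 ⊠ X) ⊞ t ⊠ (X ⊞ Q ⊠ X) ∎
      where
      distribute : ∀ w t a b c d X → (w ⊠ (a ⊞ b) ⊞ t ⊠ (c ⊞ d)) ⊠ X ≋ w ⊠ (a ⊠ X ⊞ b ⊠ X) ⊞ t ⊠ (c ⊠ X ⊞ d ⊠ X)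
      distribute = solve 7 (λ w t a b c d X → (w :* (a :+ b) :+ t :* (c :+ d)) :* X
                                           := w :* (a :* X :+ b :* X) :+ t :* (c :* X :+ d :* X)) Ser.refl

    U-factor-below : ∀ D e k → AgreeBelow D (U (suc e) k) (Q ⊠ U e k)
    U-factor-below zero e k i j ()
    U-factor-below (suc D) e k =
      agreeBelow-trans (agreeBelow-≋ (U-firstStep e k))
        (agreeBelow-trans (agreeBelow-⊞ (agreeBelow-w⊠ east) (agreeBelow-t⊠ north)) (agreeBelow-≋ (Ser.sym (Q⊠-firstStep X))))
      where
      X = U e k
      twoSteps : AgreeBelow D (U (suc (suc e)) k) (U 2 0 ⊠ X)
      twoSteps =
        agreeBelow-trans (U-factor-below D (suc e) k)
          (agreeBelow-trans (agreeBelow-⊠ (agreeBelow-≋ (Ser.refl {Q})) (U-factor-below D e k))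
            (agreeBelow-trans (agreeBelow-≋ (Ser.sym (Ser.*-assoc Q Q X)))
              (agreeBelow-⊠ (agreeBelow-sym (U-factor-below D 1 0)) (agreeBelow-≋ (Ser.refl {X})))))
      east : AgreeBelow D (U (suc e) k ⊞ U (suc (suc e)) k) (Q ⊠ X ⊞ U 2 0 ⊠ X)
      east = agreeBelow-⊞ (U-factor-below D e k) twoSteps
      north : AgreeBelow D (U e k ⊞ U (suc e) k) (X ⊞ Q ⊠ X)
      north = agreeBelow-⊞ (agreeBelow-≋ (Ser.refl {X})) (U-factor-below D e k)

    U-factor : ∀ e k → U (suc e) k ≋ Q ⊠ U e k
    U-factor e k = agreeBelow-all (λ D → U-factor-below D e k)

  swap : ∀ y z A B C → y ⊠ (A ⊞ B) ⊞ z ⊠ (C ⊞ A) ≋ z ⊠ (A ⊞ C) ⊞ y ⊠ (B ⊞ A)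
  swap = solve 5 (λ y z A B C → y :* (A :+ B) :+ z :* (C :+ A) := z :* (A :+ C) :+ y :* (B :+ A)) Ser.refl

  module Ahead = FirstPassage yS zS agreeBelow-yS⊠ agreeBelow-zS⊠ (λ e k → pairSeries (+ e) k)
                   (λ e k → pairSeries-firstStep +[1+ e ] k k (λ n r → refl) refl) pairSeries-00

  behind-firstStep : ∀ e k → pairSeries (ℤ.- + suc e) k
                           ≋ zS ⊠ (pairSeries (ℤ.- + suc e) k ⊞ pairSeries (ℤ.- + suc (suc e)) k)
                             ⊞ yS ⊠ (pairSeries (ℤ.- + e) k ⊞ pairSeries (ℤ.- + suc e) k)
  behind-firstStep zero k =
    Ser.trans (pairSeries-firstStep -[1+ 0 ] k k (λ n r → refl) refl)
              (swap yS zS (pairSeries -[1+ 0 ] k) (pairSeries (+ 0) k) (pairSeries -[1+ 1 ] k))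
  behind-firstStep (suc e) k =
    Ser.trans (pairSeries-firstStep -[1+ suc e ] k k (λ n r → refl) refl)
              (swap yS zS (pairSeries -[1+ suc e ] k) (pairSeries -[1+ e ] k) (pairSeries -[1+ suc (suc e) ] k))

  module Behind = FirstPassage zS yS agreeBelow-zS⊠ agreeBelow-yS⊠ (λ e k → pairSeries (ℤ.- + e) k)
                    behind-firstStep pairSeries-00

  Q⁺ Q⁻ : PS
  Q⁺ = Ahead.Q
  Q⁻ = Behind.Q

  excursion : PS
  excursion = (yS ⊞ zS) ⊞ (yS ⊠ Q⁺ ⊞ zS ⊠ Q⁻)

  pairSeries-meeting : ∀ k → pairSeries (+ 0) (suc k) ≋ excursion ⊠ pairSeries (+ 0) k
  pairSeries-meeting k = begin
    pairSeries (+ 0) (suc k)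
      ≈⟨ pairSeries-firstStep (+ 0) (suc k) k (λ n r → refl) refl ⟩
    yS ⊠ (X ⊞ pairSeries (+ 1) k) ⊞ zS ⊠ (pairSeries -[1+ 0 ] k ⊞ X)
      ≈⟨ Ser.+-cong (Ser.*-cong (Ser.refl {yS}) (Ser.+-cong (Ser.refl {X}) (Ahead.U-factor 0 k)))
                    (Ser.*-cong (Ser.refl {zS}) (Ser.+-cong (Behind.U-factor 0 k) (Ser.refl {X}))) ⟩
    yS ⊠ (X ⊞ Q⁺ ⊠ X) ⊞ zS ⊠ (Q⁻ ⊠ X ⊞ X)
      ≈⟨ collect yS zS Q⁺ Q⁻ X ⟩
    excursion ⊠ X ∎
    where
    X = pairSeries (+ 0) k
    collect : ∀ y z F G X → y ⊠ (X ⊞ F ⊠ X) ⊞ z ⊠ (G ⊠ X ⊞ X) ≋ ((y ⊞ z) ⊞ (y ⊠ F ⊞ z ⊠ G)) ⊠ X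
    collect = solve 5 (λ y z F G X → y :* (X :+ F :* X) :+ z :* (G :* X :+ X)
                                   := ((y :+ z) :+ (y :* F :+ z :* G)) :* X) Ser.refl

  pairSeries-power : ∀ k → pairSeries (+ 0) k ≋ excursion ^ k
  pairSeries-power zero = pairSeries-00
  pairSeries-power (suc k) = Ser.trans (pairSeries-meeting k) (Ser.*-cong (Ser.refl {excursion}) (pairSeries-power k))

  M⁺ M⁻ : PS
  M⁺ i j = Q⁺ i (suc j)
  M⁻ i j = Q⁻ (suc i) j

  Q⁺≋zS⊠M⁺ : Q⁺ ≋ zS ⊠ M⁺
  Q⁺≋zS⊠M⁺ i zero = trans (cong (λ n → + pairCount n (+ 1) i 0) (ℕP.+-identityʳ i))
                           (trans (cong +_ (pairCount-ahead-allEast i 0 0)) (sym (zS⊠-zero M⁺ i)))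
  Q⁺≋zS⊠M⁺ i (suc j) = sym (zS⊠-suc M⁺ i j)

  Q⁻≋yS⊠M⁻ : Q⁻ ≋ yS ⊠ M⁻
  Q⁻≋yS⊠M⁻ zero j = trans (cong +_ (pairCount-behind-allNorth j 0 0)) (sym (yS⊠-zero M⁻ j))
  Q⁻≋yS⊠M⁻ (suc i) j = sym (yS⊠-suc M⁻ i j)

  Φ : PS → PS
  Φ M = 𝟏 ⊞ yS ⊠ M ⊞ zS ⊠ M ⊞ (yS ⊠ zS) ⊠ (M ⊠ M)

  M⁺-fixed : M⁺ ≋ Φ M⁺
  M⁺-fixed = zS⊠-cancel (begin
    zS ⊠ M⁺
      ≈⟨ Ser.sym Q⁺≋zS⊠M⁺ ⟩
    Q⁺
      ≈⟨ pairSeries-firstStep (+ 1) 0 0 (λ n r → refl) refl ⟩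
    yS ⊠ (Q⁺ ⊞ pairSeries (+ 2) 0) ⊞ zS ⊠ (pairSeries (+ 0) 0 ⊞ Q⁺)
      ≈⟨ Ser.+-cong (Ser.*-cong (Ser.refl {yS}) (Ser.+-cong Q⁺≋zS⊠M⁺ (Ser.trans (Ahead.U-factor 1 0) (Ser.*-cong Q⁺≋zS⊠M⁺ Q⁺≋zS⊠M⁺))))
                    (Ser.*-cong (Ser.refl {zS}) (Ser.+-cong (Ser.trans pairSeries-00 (Ser.sym 𝟏≋𝟙)) Q⁺≋zS⊠M⁺)) ⟩
    yS ⊠ (zS ⊠ M⁺ ⊞ (zS ⊠ M⁺) ⊠ (zS ⊠ M⁺)) ⊞ zS ⊠ (𝟏 ⊞ zS ⊠ M⁺)
      ≈⟨ regroup yS zS M⁺ ⟩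
    zS ⊠ Φ M⁺ ∎)
    where
    regroup : ∀ y z M → y ⊠ (z ⊠ M ⊞ (z ⊠ M) ⊠ (z ⊠ M)) ⊞ z ⊠ (𝟏 ⊞ z ⊠ M) ≋ z ⊠ (𝟏 ⊞ y ⊠ M ⊞ z ⊠ M ⊞ (y ⊠ z) ⊠ (M ⊠ M))
    regroup = solve 3 (λ y z M → y :* (z :* M :+ (z :* M) :* (z :* M)) :+ z :* (con (+ 1) :+ z :* M)
                               := z :* (con (+ 1) :+ y :* M :+ z :* M :+ (y :* z) :* (M :* M))) Ser.refl

  M⁻-fixed : M⁻ ≋ Φ M⁻
  M⁻-fixed = yS⊠-cancel (begin
    yS ⊠ M⁻
      ≈⟨ Ser.sym Q⁻≋yS⊠M⁻ ⟩
    Q⁻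
      ≈⟨ behind-firstStep 0 0 ⟩
    zS ⊠ (Q⁻ ⊞ pairSeries -[1+ 1 ] 0) ⊞ yS ⊠ (pairSeries (+ 0) 0 ⊞ Q⁻)
      ≈⟨ Ser.+-cong (Ser.*-cong (Ser.refl {zS}) (Ser.+-cong Q⁻≋yS⊠M⁻ (Ser.trans (Behind.U-factor 1 0) (Ser.*-cong Q⁻≋yS⊠M⁻ Q⁻≋yS⊠M⁻))))
                    (Ser.*-cong (Ser.refl {yS}) (Ser.+-cong (Ser.trans pairSeries-00 (Ser.sym 𝟏≋𝟙)) Q⁻≋yS⊠M⁻)) ⟩
    zS ⊠ (yS ⊠ M⁻ ⊞ (yS ⊠ M⁻) ⊠ (yS ⊠ M⁻)) ⊞ yS ⊠ (𝟏 ⊞ yS ⊠ M⁻)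
      ≈⟨ regroup yS zS M⁻ ⟩
    yS ⊠ Φ M⁻ ∎)
    where
    regroup : ∀ y z M → z ⊠ (y ⊠ M ⊞ (y ⊠ M) ⊠ (y ⊠ M)) ⊞ y ⊠ (𝟏 ⊞ y ⊠ M) ≋ y ⊠ (𝟏 ⊞ y ⊠ M ⊞ z ⊠ M ⊞ (y ⊠ z) ⊠ (M ⊠ M))
    regroup = solve 3 (λ y z M → z :* (y :* M :+ (y :* M) :* (y :* M)) :+ y :* (con (+ 1) :+ y :* M)
                               := y :* (con (+ 1) :+ y :* M :+ z :* M :+ (y :* z) :* (M :* M))) Ser.refl

  agreeBelow-Φ : ∀ {D X Y} → AgreeBelow D X Y → AgreeBelow (suc D) (Φ X) (Φ Y)
  agreeBelow-Φ {D} {X} {Y} X~Y =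
    agreeBelow-⊞ (agreeBelow-⊞ (agreeBelow-⊞ (agreeBelow-≋ (Ser.refl {𝟏})) (agreeBelow-yS⊠ X~Y)) (agreeBelow-zS⊠ X~Y))
      (agreeBelow-trans (agreeBelow-≋ (Ser.*-assoc yS zS (X ⊠ X)))
        (agreeBelow-trans (agreeBelow-≤ (ℕP.n≤1+n (suc D)) (agreeBelow-yS⊠ (agreeBelow-zS⊠ (agreeBelow-⊠ X~Y X~Y))))
          (agreeBelow-≋ (Ser.sym (Ser.*-assoc yS zS (Y ⊠ Y))))))

  Φ-fixed-unique : ∀ {X Y} → X ≋ Φ X → Y ≋ Φ Y → X ≋ Y
  Φ-fixed-unique {X} {Y} X-fixed Y-fixed = agreeBelow-all below
    where
    below : ∀ D → AgreeBelow D X Y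
    below zero i j ()
    below (suc D) = agreeBelow-trans (agreeBelow-≋ X-fixed)
                      (agreeBelow-trans (agreeBelow-Φ (below D)) (agreeBelow-≋ (Ser.sym Y-fixed)))

  f₀ : PS
  f₀ = yS ⊠ Q⁺

  zS⊠Q⁻≋f₀ : zS ⊠ Q⁻ ≋ f₀
  zS⊠Q⁻≋f₀ = begin
    zS ⊠ Q⁻ ≈⟨ Ser.*-cong (Ser.refl {zS}) Q⁻≋yS⊠M⁻ ⟩
    zS ⊠ (yS ⊠ M⁻) ≈⟨ Ser.*-cong (Ser.refl {zS}) (Ser.*-cong (Ser.refl {yS}) (Φ-fixed-unique M⁻-fixed M⁺-fixed)) ⟩
    zS ⊠ (yS ⊠ M⁺) ≈⟨ Ser.sym (Ser.*-assoc zS yS M⁺) ⟩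
    (zS ⊠ yS) ⊠ M⁺ ≈⟨ Ser.*-cong (Ser.*-comm zS yS) (Ser.refl {M⁺}) ⟩
    (yS ⊠ zS) ⊠ M⁺ ≈⟨ Ser.*-assoc yS zS M⁺ ⟩
    yS ⊠ (zS ⊠ M⁺) ≈⟨ Ser.*-cong (Ser.refl {yS}) (Ser.sym Q⁺≋zS⊠M⁺) ⟩
    f₀ ∎

  excursion≋y+z+2f₀ : excursion ≋ (yS ⊞ zS) ⊞ (f₀ ⊞ f₀)
  excursion≋y+z+2f₀ = Ser.+-cong (Ser.refl {yS ⊞ zS}) (Ser.+-cong (Ser.refl {f₀}) zS⊠Q⁻≋f₀)

  f₀-equation : f₀ ≋ (yS ⊞ f₀) ⊠ (zS ⊞ f₀)
  f₀-equation = begin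
    f₀ ≈⟨ Ser.*-cong (Ser.refl {yS}) Q⁺≋zS⊠M⁺ ⟩
    yS ⊠ (zS ⊠ M⁺) ≈⟨ Ser.*-cong (Ser.refl {yS}) (Ser.*-cong (Ser.refl {zS}) M⁺-fixed) ⟩
    yS ⊠ (zS ⊠ Φ M⁺) ≈⟨ expand yS zS M⁺ ⟩
    (yS ⊞ yS ⊠ (zS ⊠ M⁺)) ⊠ (zS ⊞ yS ⊠ (zS ⊠ M⁺))
      ≈⟨ Ser.sym (Ser.*-cong (Ser.+-cong (Ser.refl {yS}) f₀≋yS⊠zS⊠M⁺) (Ser.+-cong (Ser.refl {zS}) f₀≋yS⊠zS⊠M⁺)) ⟩
    (yS ⊞ f₀) ⊠ (zS ⊞ f₀) ∎
    where
    f₀≋yS⊠zS⊠M⁺ : f₀ ≋ yS ⊠ (zS ⊠ M⁺)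
    f₀≋yS⊠zS⊠M⁺ = Ser.*-cong (Ser.refl {yS}) Q⁺≋zS⊠M⁺
    expand : ∀ y z M → y ⊠ (z ⊠ (𝟏 ⊞ y ⊠ M ⊞ z ⊠ M ⊞ (y ⊠ z) ⊠ (M ⊠ M))) ≋ (y ⊞ y ⊠ (z ⊠ M)) ⊠ (z ⊞ y ⊠ (z ⊠ M))
    expand = solve 3 (λ y z M → y :* (z :* (con (+ 1) :+ y :* M :+ z :* M :+ (y :* z) :* (M :* M)))
                             := (y :+ y :* (z :* M)) :* (z :+ y :* (z :* M))) Ser.refl

  N≡excursion-power : ∀ k m r → r ≤ suc m → + N k (suc m) r ≡ (excursion ^ suc k) r (suc m ∸ r)
  N≡excursion-power k m r r≤n =
    trans (cong +_ (N≡pairCount k m r))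
      (trans (cong (λ n → + pairCount n (+ 0) r (suc k)) (sym (ℕP.m+[n∸m]≡n r≤n)))
        (pairSeries-power (suc k) r (suc m ∸ r)))

module SquareRoot where

  open import Defs
  open Bivariate
  open PairSeries using (Q⁺; f₀; f₀-equation)
  open import Data.Integer as ℤ using (ℤ; +_)
  import Data.Integer.Properties as ℤP
  open import Data.Product using (_,_)
  open import Relation.Binary.PropositionalEquality using (_≡_; _≢_; refl; sym; trans; cong; cong₂; subst)
  open import Algebra.Properties.Group Ser.+-group using (x∙y⁻¹≈ε⇒x≈y)
  open import Relation.Binary.Reasoning.Setoid Ser.setoid

  a₀ g₀ : PS
  a₀ = oneS ⊖ yS ⊖ zS
  g₀ = a₀ ⊖ scale (+ 2) f₀

  g₀-00 : g₀ 0 0 ≡ + 1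
  g₀-00 = cong (λ c → + 1 ℤ.- + 2 ℤ.* c) (yS⊠-zero Q⁺ 0)

  g₀-squared : g₀ ⊛ g₀ ≋ disc
  g₀-squared = begin
    g₀ ⊛ g₀
      ≈⟨ ⊛≋⊠ g₀ g₀ ⟩
    g₀ ⊠ g₀
      ≈⟨ Ser.*-cong g₀≋ g₀≋ ⟩
    (a ⊞ ⊟ (constant (+ 2) ⊠ f₀)) ⊠ (a ⊞ ⊟ (constant (+ 2) ⊠ f₀))
      ≈⟨ complete-square yS zS f₀ ⟩
    (a ⊠ a ⊞ ⊟ (constant (+ 4) ⊠ (yS ⊠ zS))) ⊞ constant (+ 4) ⊠ ((yS ⊞ f₀) ⊠ (zS ⊞ f₀) ⊞ ⊟ f₀)
      ≈⟨ Ser.+-cong (Ser.refl {a ⊠ a ⊞ ⊟ (constant (+ 4) ⊠ (yS ⊠ zS))}) (Ser.trans (Ser.*-cong (Ser.refl {constant (+ 4)}) vanishes) (Ser.zeroʳ _)) ⟩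
    (a ⊠ a ⊞ ⊟ (constant (+ 4) ⊠ (yS ⊠ zS))) ⊞ 𝟘
      ≈⟨ Ser.+-identityʳ _ ⟩
    a ⊠ a ⊞ ⊟ (constant (+ 4) ⊠ (yS ⊠ zS))
      ≈⟨ Ser.+-cong (Ser.trans (Ser.*-cong (Ser.sym a₀≋) (Ser.sym a₀≋)) (Ser.sym (⊛≋⊠ a₀ a₀)))
                    (Ser.-‿cong (Ser.trans (constant⊠ (+ 4) (yS ⊠ zS)) (λ i j → cong (+ 4 ℤ.*_) (sym (⊛≋⊠ yS zS i j))))) ⟩
    disc ∎
    where
    a = 𝟏 ⊞ ⊟ yS ⊞ ⊟ zS
    a₀≋ : a₀ ≋ a
    a₀≋ = Ser.+-cong (Ser.+-cong (Ser.trans oneS≋𝟙 (Ser.sym 𝟏≋𝟙)) (Ser.refl {⊟ yS})) (Ser.refl {⊟ zS})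
    g₀≋ : g₀ ≋ a ⊞ ⊟ (constant (+ 2) ⊠ f₀)
    g₀≋ = Ser.+-cong a₀≋ (Ser.-‿cong (Ser.sym (constant⊠ (+ 2) f₀)))
    vanishes : (yS ⊞ f₀) ⊠ (zS ⊞ f₀) ⊞ ⊟ f₀ ≋ 𝟘
    vanishes = Ser.trans (Ser.+-cong (Ser.sym f₀-equation) (Ser.refl {⊟ f₀})) (Ser.-‿inverseʳ f₀)
    complete-square : ∀ y z F →
      (𝟏 ⊞ ⊟ y ⊞ ⊟ z ⊞ ⊟ (constant (+ 2) ⊠ F)) ⊠ (𝟏 ⊞ ⊟ y ⊞ ⊟ z ⊞ ⊟ (constant (+ 2) ⊠ F))
      ≋ ((𝟏 ⊞ ⊟ y ⊞ ⊟ z) ⊠ (𝟏 ⊞ ⊟ y ⊞ ⊟ z) ⊞ ⊟ (constant (+ 4) ⊠ (y ⊠ z))) ⊞ constant (+ 4) ⊠ ((y ⊞ F) ⊠ (z ⊞ F) ⊞ ⊟ F)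
    complete-square = solve 3 (λ y z F →
      (con (+ 1) :+ :- y :+ :- z :+ :- (con (+ 2) :* F)) :* (con (+ 1) :+ :- y :+ :- z :+ :- (con (+ 2) :* F))
      := ((con (+ 1) :+ :- y :+ :- z) :* (con (+ 1) :+ :- y :+ :- z) :+ :- (con (+ 4) :* (y :* z)))
         :+ con (+ 4) :* ((y :+ F) :* (z :+ F) :+ :- F)) Ser.refl

  sqrt-unique : ∀ g → IsSqrt g disc → g ≋ g₀
  sqrt-unique g (g-00 , g-squared) = x∙y⁻¹≈ε⇒x≈y g g₀ (⊠≋𝟘⇒≋𝟘 (g ⊞ ⊟ g₀) (g ⊞ g₀) product≋𝟘 constant≢0)
    where
    constant≢0 : (g ⊞ g₀) 0 0 ≢ + 0
    constant≢0 = subst (_≢ + 0) (sym (cong₂ ℤ._+_ g-00 g₀-00)) (λ ())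
    product≋𝟘 : (g ⊞ ⊟ g₀) ⊠ (g ⊞ g₀) ≋ 𝟘
    product≋𝟘 = begin
      (g ⊞ ⊟ g₀) ⊠ (g ⊞ g₀) ≈⟨ difference-of-squares g g₀ ⟩
      g ⊠ g ⊞ ⊟ (g₀ ⊠ g₀) ≈⟨ Ser.+-cong same-square (Ser.refl {⊟ (g₀ ⊠ g₀)}) ⟩
      g₀ ⊠ g₀ ⊞ ⊟ (g₀ ⊠ g₀) ≈⟨ Ser.-‿inverseʳ (g₀ ⊠ g₀) ⟩
      𝟘 ∎
      where
      same-square : g ⊠ g ≋ g₀ ⊠ g₀
      same-square = Ser.trans (Ser.sym (⊛≋⊠ g g)) (Ser.trans g-squared (Ser.trans (Ser.sym g₀-squared) (⊛≋⊠ g₀ g₀)))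
      difference-of-squares : ∀ g h → (g ⊞ ⊟ h) ⊠ (g ⊞ h) ≋ g ⊠ g ⊞ ⊟ (h ⊠ h)
      difference-of-squares = solve 2 (λ g h → (g :+ :- h) :* (g :+ h) := g :* g :+ :- (h :* h)) Ser.refl

open import Defs
open import Data.Product using (Σ; _×_)
open import Data.Integer using (+_)
import Data.Integer.Properties as ℤP
open import Relation.Binary.PropositionalEquality using (_≡_; refl; trans)
open Bivariate
open import Algebra.Properties.Semiring.Exp Ser.semiring using (_^_; ^-congˡ)
open PairSeries using (f₀; f₀-equation; excursion; excursion≋y+z+2f₀; N≡excursion-power)
open SquareRoot

^S≋^ : ∀ X k → X ^S k ≋ X ^ k
^S≋^ X 0 = oneS≋𝟙
^S≋^ X (suc k) = Ser.trans (⊛≋⊠ X (X ^S k)) (Ser.*-cong (Ser.refl {X}) (^S≋^ X k))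

f-unique : ∀ g → IsSqrt g disc → ∀ f → scale (+ 2) f ≈ ((oneS ⊖ yS ⊖ zS) ⊖ g) → f ≋ f₀
f-unique g g-sqrt f 2f≈ i j = ℤP.*-cancelˡ-≡ (+ 2) (f i j) (f₀ i j) (trans (2f≈ i j) (halves i j))
  where
  halves : a₀ ⊖ g ≋ scale (+ 2) f₀
  halves = Ser.trans (Ser.+-cong (Ser.refl {a₀}) (Ser.-‿cong (sqrt-unique g g-sqrt)))
                     (cancel a₀ (scale (+ 2) f₀))
    where
    cancel : ∀ a s → a ⊞ ⊟ (a ⊞ ⊟ s) ≋ s
    cancel = solve 2 (λ a s → a :+ :- (a :+ :- s) := s) Ser.refl

f-equation : ∀ f → f ≋ f₀ → f ≈ ((yS ⊕ f) ⊛ (zS ⊕ f))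
f-equation f f≋f₀ = Ser.trans f≋f₀ (Ser.trans f₀-equation (Ser.trans
  (Ser.*-cong (Ser.+-cong (Ser.refl {yS}) (Ser.sym f≋f₀)) (Ser.+-cong (Ser.refl {zS}) (Ser.sym f≋f₀)))
  (Ser.sym (⊛≋⊠ (yS ⊕ f) (zS ⊕ f)))))

N-coefficient : ∀ f → f ≋ f₀ → (k n r : ℕ) → 1 ≤ n → r ≤ n →
                + N k n r ≡ ((((yS ⊕ zS) ⊕ scale (+ 2) f) ^S suc k) r (n ∸ r))
N-coefficient f f≋f₀ k (suc m) r (s≤s _) r≤n =
  trans (N≡excursion-power k m r r≤n) (Ser.sym (Ser.trans (^S≋^ y+z+2f (suc k)) (^-congˡ (suc k) y+z+2f≋excursion)) r (suc m ∸ r))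
  where
  y+z+2f : PS
  y+z+2f = (yS ⊕ zS) ⊕ scale (+ 2) f
  doubled : scale (+ 2) f ≋ f₀ ⊞ f₀
  doubled = Ser.trans (Ser.sym (constant⊠ (+ 2) f))
              (Ser.trans (Ser.*-cong (Ser.refl {constant (+ 2)}) f≋f₀) (solve 1 (λ F → con (+ 2) :* F := F :+ F) Ser.refl f₀))
  y+z+2f≋excursion : y+z+2f ≋ excursion
  y+z+2f≋excursion = Ser.trans (Ser.+-cong (Ser.refl {yS ⊞ zS}) doubled) (Ser.sym excursion≋y+z+2f₀)

mainTheorem2 : Σ PS (λ g → IsSqrt g disc)
    × ((g : PS) → IsSqrt g disc → (f : PS) →
    scale (+ 2) f ≈ ((oneS ⊖ yS ⊖ zS) ⊖ g) →
    (f ≈ ((yS ⊕ f) ⊛ (zS ⊕ f)))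
    × ((k n r : ℕ) → 1 ≤ n → r ≤ n →
    + N k n r ≡ ((((yS ⊕ zS) ⊕ scale (+ 2) f) ^S suc k) r (n ∸ r))))
mainTheorem2 = (g₀ , g₀-00 , g₀-squared) , λ g g-sqrt f 2f≈ →
  f-equation f (f-unique g g-sqrt f 2f≈) , N-coefficient f (f-unique g g-sqrt f 2f≈)
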